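{- Let $H$ be a finite $k$-graph, $v \in V(H)$, fix a linear ordering $\prec$ of $V(H)$, let $T(H,v)$ be the $k$-walk-tree of $H$ rooted at $v$ with respect to $\prec$, and let $V = (v)$. Then $$\mathcal{P}_H(\overline{v}) = \mathcal{P}_{T(H,v)}(\overline{V}).$$
   Context: A $k$-graph is a $k$-uniform hypergraph. For a finite $k$-graph $G$, let $M$ be a matching (set of pairwise vertex-disjoint edges, the empty one included) chosen uniformly at random among all matchings of $G$; $\mathcal{P}_G(\overline{u})$ is the probability that no edge of $M$ contains $u$. A Berge-path is a sequence $(v_0, e_1, v_1, \dots, e_\ell, v_\ell)$ of distinct vertices and distinct edges with $v_{i-1}, v_i \in e_i$. Given $\prec$, for $\ell\ge1$ write $e_i = \{v_{i-1}, u_{(i,1)}, \dots, u_{(i,k-2)}, v_i\}$ and $C_i = \{u_{(i,j)} : u_{(i,j)} \prec v_i, j\in[k-2]\} \cup \{v_{i-1}\}$; the Berge-path is a conflict-free walk if for each $2 \le i \le \ell$, $e_i$ is disjoint from $\bigcup_{j<i} C_j$; the one-vertex sequence $(v)$ is also a conflict-free walk. The $k$-walk-tree $T(H,v)$ has as vertices the conflict-free walks starting at $v$, and $W_0,\dots,W_{k-1}$ form an edge whenever there is $e = \{u_0,\dots,u_{k-1}\} \in E(H)$ such that $W_0$ ends at $u_0$ and each $W_i$ ($i\in[k-1]$) is obtained from $W_0$ by appending $e$ and then $u_i$. The one-vertex walk $V=(v)$ is a vertex of $T(H,v)$. -}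

module Defs where

open import Level using (0ℓ)
open import Data.Bool using (Bool; true; false; _∧_; not; if_then_else_)
open import Data.Nat using (ℕ; zero; suc; NonZero; >-nonZero; _>_; z<s)
open import Data.Fin using (Fin)
open import Data.Fin.Subset using (Subset; ∣_∣)
open import Data.Vec using (lookup)
open import Data.List using (List; []; _∷_; _++_; [_]; map; length; filterᵇ; allFin; concatMap)
open import Data.Bool.ListAction using (all; any)
open import Data.List.Relation.Unary.All using (All)
open import Data.List.Relation.Unary.Unique.Propositional using (Unique)
open import Data.Product using (Σ; ∃; _×_; _,_; proj₁; proj₂)
open import Data.Integer using (+_)
open import Data.Rational using (ℚ; _/_)
open import Relation.Nullary using (does)
open import Relation.Binary using (Rel; IsStrictTotalOrder)
open import Relation.Binary.Definitions using (DecidableEquality)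
open import Relation.Binary.PropositionalEquality using (_≡_; refl)
import Data.Fin as F
import Data.Vec.Properties as VP
import Data.List.Properties as LP
import Data.Product.Properties as PP
import Data.Bool as B

-- Matchings and the probability P_G(ū) in a finite hypergraph whose
-- vertices come from a type with decidable equality and whose edge set
-- is given by a duplicate-free list of edges, each edge being the list
-- of its vertices.

-- all sub-lists (chosen by position); for a duplicate-free list these
-- are exactly the subsets of the edge set.
sublists : ∀ {A : Set} → List A → List (List A)
sublists []       = [] ∷ []
sublists (x ∷ xs) = sublists xs ++ map (x ∷_) (sublists xs)

module Matchings {V : Set} (_≟_ : DecidableEquality V) where

  elem : V → List V → Bool
  elem x xs = any (λ y → does (x ≟ y)) xs

  disjoint : List V → List V → Bool
  disjoint xs ys = all (λ x → not (elem x ys)) xs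

  isMatching : List (List V) → Bool
  isMatching []       = true
  isMatching (e ∷ es) = all (disjoint e) es ∧ isMatching es

  matchings : List (List V) → List (List (List V))
  matchings E = filterᵇ isMatching (sublists E)

  avoids : V → List (List V) → Bool
  avoids u M = all (λ e → not (elem u e)) M

  #matchings : List (List V) → ℕ
  #matchings E = length (matchings E)

  #avoiding : List (List V) → V → ℕ
  #avoiding E u = length (filterᵇ (avoids u) (matchings E))

  private
    sublists-head : ∀ {A : Set} (xs : List A) → ∃ λ r → sublists xs ≡ [] ∷ r
    sublists-head []       = [] , refl
    sublists-head (x ∷ xs) with sublists xs | sublists-head xs
    ... | .([] ∷ r) | r , refl = (r ++ map (x ∷_) ([] ∷ r)) , refl

  #matchings>0 : ∀ E → #matchings E > 0
  #matchings>0 E with sublists E | sublists-head E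
  ... | .([] ∷ r) | r , refl = z<s

  #matchings-nonZero : ∀ E → NonZero (#matchings E)
  #matchings-nonZero E = >-nonZero (#matchings>0 E)

  prob : List (List V) → V → ℚ
  prob E u = _/_ (+ #avoiding E u) (#matchings E) {{#matchings-nonZero E}}

record KGraph (k : ℕ) : Set where
  field
    n        : ℕ
    edges    : List (Subset n)
    uniform  : All (λ e → ∣ e ∣ ≡ k) edges
    distinct : Unique edges
open KGraph public

subset-≟ : ∀ {n} → DecidableEquality (Subset n)
subset-≟ = VP.≡-dec B._≟_

members : ∀ {n} → Subset n → List (Fin n)
members e = filterᵇ (lookup e) (allFin _)

module _ {k : ℕ} (H : KGraph k) where

  open Matchings (F._≟_ {n H}) renaming (prob to probF)

  probH : Fin (n H) → ℚ
  probH v = probF (map members (edges H)) v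

  -- A walk starting at v is encoded by the list of its steps
  -- (e_1 , v_1) , … , (e_ℓ , v_ℓ); the walk is (v, e_1, v_1, …, e_ℓ, v_ℓ).
  Step : Set
  Step = Subset (n H) × Fin (n H)

  Walk : Set
  Walk = List Step

  step-≟ : DecidableEquality Step
  step-≟ = PP.≡-dec subset-≟ F._≟_

  walk-≟ : DecidableEquality Walk
  walk-≟ = LP.≡-dec step-≟

  allDistinct : ∀ {A : Set} → DecidableEquality A → List A → Bool
  allDistinct _≟A_ []       = true
  allDistinct _≟A_ (x ∷ xs) = all (λ y → not (does (x ≟A y))) xs ∧ allDistinct _≟A_ xs

  isEdge : Subset (n H) → Bool
  isEdge e = any (λ f → does (subset-≟ e f)) (edges H)

  consecutive : Fin (n H) → Walk → Bool
  consecutive prev []             = true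
  consecutive prev ((e , w) ∷ ws) = lookup e prev ∧ lookup e w ∧ consecutive w ws

  isBergePath : Fin (n H) → Walk → Bool
  isBergePath v ws =
    allDistinct F._≟_ (v ∷ map proj₂ ws) ∧
    allDistinct subset-≟ (map proj₁ ws) ∧
    all isEdge (map proj₁ ws) ∧
    consecutive v ws

  module _ {_≺_ : Rel (Fin (n H)) 0ℓ} (≺-sto : IsStrictTotalOrder _≡_ _≺_) where

    open IsStrictTotalOrder ≺-sto using (_<?_)

    C : Fin (n H) → Subset (n H) → Fin (n H) → List (Fin (n H))
    C prev e w = prev ∷ filterᵇ (λ u → lookup e u ∧ not (does (u F.≟ prev)) ∧
                                       not (does (u F.≟ w)) ∧ does (u <? w))
                                (allFin (n H))

    -- conflict-freeness: e_i disjoint from C_1 ∪ … ∪ C_{i-1} (acc) for all i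
    -- (vacuous for i = 1 since acc = [] there)
    conflictFree : Fin (n H) → Walk → List (Fin (n H)) → Bool
    conflictFree prev []             acc = true
    conflictFree prev ((e , w) ∷ ws) acc =
      all (λ u → not (lookup e u)) acc ∧ conflictFree w ws (acc ++ C prev e w)

    isCFWalk : Fin (n H) → Walk → Bool
    isCFWalk v ws = isBergePath v ws ∧ conflictFree v ws []

    listsUpTo : ∀ {A : Set} → List A → ℕ → List (List A)
    listsUpTo as zero    = [] ∷ []
    listsUpTo as (suc L) = [] ∷ concatMap (λ a → map (a ∷_) (listsUpTo as L)) as

    alphabet : List Step
    alphabet = concatMap (λ e → map (e ,_) (allFin (n H))) (edges H)

    -- Vertices of T(H,v): all conflict-free walks starting at v
    -- (a Berge-path has distinct edges, so its length is ≤ |E(H)|).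
    walkTreeVertices : Fin (n H) → List Walk
    walkTreeVertices v = filterᵇ (isCFWalk v) (listsUpTo alphabet (length (edges H)))

    endpoint : Fin (n H) → Walk → Fin (n H)
    endpoint v []             = v
    endpoint v ((e , w) ∷ ws) = endpoint w ws

    extensions : Fin (n H) → Walk → Subset (n H) → List Walk
    extensions v W₀ e =
      map (λ u → W₀ ++ [ (e , u) ])
          (filterᵇ (λ u → not (does (u F.≟ endpoint v W₀))) (members e))

    isTreeEdge : Fin (n H) → Walk → Subset (n H) → Bool
    isTreeEdge v W₀ e = lookup e (endpoint v W₀) ∧ all (isCFWalk v) (extensions v W₀ e)

    walkTreeEdges : Fin (n H) → List (List Walk)
    walkTreeEdges v =
      concatMap (λ W₀ → concatMap (λ e → if isTreeEdge v W₀ e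
                                          then [ W₀ ∷ extensions v W₀ e ] else [])
                                  (edges H))
                (walkTreeVertices v)

    -- P_{T(H,v)}(V̄) where V = (v) is the one-vertex walk
    probT : Fin (n H) → ℚ
    probT v = Matchings.prob walk-≟ (walkTreeEdges v) []

-- For a conflict-free walk W from v with end w, let R be the union of its conflict sets and T_W the subtree
-- of T(H,v) at W. We show P_{T_W}(W̄) = P_{H−R}(w̄) by induction on the number of edges of H − R; for W = (v)
-- this is the theorem. On both sides a matching either avoids the root or uses exactly one edge through it,
-- and the tree edges at W correspond to the edges e of H − R through w. Deleting W splits T_W into the
-- subtrees at the children W e u (u ∈ e − w), whose matchings combine independently. Listing these u in
-- ≺-order, the conflict set of the step (e, u) is R together with w and the vertices of e preceding u, so the
-- induction hypotheses for these children telescope, relating the matchings of H − R − e to those of H − R − w.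

module Submission where

open import Level using (0ℓ)
open import Data.Bool using (Bool; true; false; _∧_; not; if_then_else_; T)
open import Data.Bool.Properties using (∧-assoc; ∧-comm; ∧-identityʳ; T-≡)
open import Data.Bool.ListAction using (all; any)
open import Data.Empty using (⊥; ⊥-elim)
open import Data.Fin as Fin using (Fin)
open import Data.Fin.Subset using (Subset)
import Data.Integer as ℤ
open import Data.Integer.Properties using (pos-*)
open import Data.List using (List; []; _∷_; _++_; [_]; map; length; filterᵇ; allFin; concatMap; initLast; _∷ʳ′_)
import Data.List.Properties as List
open import Data.List.Membership.Propositional using (_∈_; _∉_; find; lose)
import Data.List.Membership.Propositional.Properties as ∈
open import Data.List.Membership.Propositional.Properties.WithK using (unique∧set⇒bag)
open import Data.List.Relation.Binary.BagAndSetEquality using (∼bag⇒↭; ++-cong)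
open import Data.List.Relation.Binary.Permutation.Propositional as Perm using (_↭_; ↭-sym; ↭-trans; ↭⇒↭ₛ)
import Data.List.Relation.Binary.Permutation.Propositional.Properties as ↭
import Data.List.Relation.Binary.Permutation.Setoid.Properties as ↭ₛ
import Data.List.Relation.Unary.All as All
open import Data.List.Relation.Unary.All.Properties using (all⁺; all⁻)
open import Data.List.Relation.Unary.AllPairs as AllPairs using (AllPairs)
open import Data.List.Relation.Unary.Any using (here; there)
open import Data.List.Relation.Unary.Any.Properties using (any⁺; any⁻)
open import Data.List.Relation.Unary.Sorted.TotalOrder.Properties using (Sorted⇒AllPairs)
open import Data.List.Relation.Unary.Unique.Propositional using (Unique; []; _∷_)
import Data.List.Relation.Unary.Unique.Propositional.Properties as Unique
import Data.List.Sort as Sort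
open import Data.Nat using (ℕ; zero; suc; _+_; _*_; _≤_; _<_; z≤n; s≤s; NonZero)
open import Data.Nat.Properties
  using (+-assoc; +-comm; +-identityʳ; *-assoc; *-comm; *-identityʳ; *-zeroʳ; *-distribˡ-+; *-distribʳ-+;
         ≤-refl; ≤-trans; <-≤-trans; m≤m+n; m≤n⇒m≤1+n; n<1+n; suc-injective)
open import Data.Nat.ListAction using (sum; product)
open import Data.Nat.ListAction.Properties using (sum-↭; product-↭; product-++)
open import Data.Nat.Tactic.RingSolver using (solve-∀)
open import Data.Product using (∃; _×_; _,_; proj₁; proj₂)
open import Data.Rational using (_/_)
open import Data.Rational.Properties using (fromℚᵘ-cong)
open import Data.Rational.Unnormalised using (mkℚᵘ; *≡*)
open import Data.Sum using (_⊎_; inj₁; inj₂)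
open import Data.Vec using (lookup)
import Data.Vec.Properties as VecP
open import Function using (_∘_; _⇔_; mk⇔; Equivalence)
open import Function.Properties.Equivalence using () renaming (refl to ⇔-refl; sym to ⇔-sym)
open import Relation.Binary using (Rel; IsStrictTotalOrder; DecTotalOrder)
import Relation.Binary.Construct.StrictToNonStrict as StrictToNonStrict
open import Relation.Binary.Definitions using (DecidableEquality)
open import Relation.Binary.PropositionalEquality hiding ([_])
open import Relation.Nullary using (does; yes; no)
open import Relation.Nullary.Decidable using (T?)

open import Defs

∧-trueˡ : ∀ {a b} → a ∧ b ≡ true → a ≡ true
∧-trueˡ {true} _ = refl

∧-trueʳ : ∀ {a b} → a ∧ b ≡ true → b ≡ true
∧-trueʳ {true} h = h

∧-true⁺ : ∀ {a b} → a ≡ true → b ≡ true → a ∧ b ≡ true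
∧-true⁺ refl refl = refl

not-true⁻ : ∀ {b} → not b ≡ true → b ≡ false
not-true⁻ {false} _ = refl

not-true⁺ : ∀ {b} → b ≡ false → not b ≡ true
not-true⁺ refl = refl

true≢false : ∀ {b} → b ≡ true → b ≢ false
true≢false refl ()

≢true⇒false : ∀ {b} → b ≢ true → b ≡ false
≢true⇒false {true}  b≢t = ⊥-elim (b≢t refl)
≢true⇒false {false} _   = refl

true⇔⇒≡ : ∀ {a b} → (a ≡ true → b ≡ true) → (b ≡ true → a ≡ true) → a ≡ b
true⇔⇒≡ {true}  {true}  _ _ = refl
true⇔⇒≡ {true}  {false} f _ = sym (f refl)
true⇔⇒≡ {false} {true}  _ g = g refl
true⇔⇒≡ {false} {false} _ _ = refl

private
  T⇒true : ∀ {b} → T b → b ≡ true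
  T⇒true = Equivalence.to T-≡

  true⇒T : ∀ {b} → b ≡ true → T b
  true⇒T = Equivalence.from T-≡

module _ {A : Set} (_≟_ : DecidableEquality A) where

  does-true⁻ : ∀ {x y} → does (x ≟ y) ≡ true → x ≡ y
  does-true⁻ {x} {y} h with x ≟ y
  ... | yes x≡y = x≡y

  does-refl : ∀ x → does (x ≟ x) ≡ true
  does-refl x with x ≟ x
  ... | yes _   = refl
  ... | no x≢x = ⊥-elim (x≢x refl)

  does-false⁺ : ∀ {x y} → x ≢ y → does (x ≟ y) ≡ false
  does-false⁺ {x} {y} x≢y with x ≟ y
  ... | yes x≡y = ⊥-elim (x≢y x≡y)
  ... | no _    = refl

  does-false⁻ : ∀ {x y} → does (x ≟ y) ≡ false → x ≢ y
  does-false⁻ {x} {y} h with x ≟ y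
  ... | no x≢y = x≢y

module _ {A : Set} {p : A → Bool} where

  all-elim : ∀ {xs x} → all p xs ≡ true → x ∈ xs → p x ≡ true
  all-elim {xs} h x∈xs = T⇒true (All.lookup (all⁺ p xs (true⇒T h)) x∈xs)

  all-intro : ∀ xs → (∀ {x} → x ∈ xs → p x ≡ true) → all p xs ≡ true
  all-intro xs f = T⇒true (all⁻ p (All.tabulate (true⇒T ∘ f)))

  all-false : ∀ {xs x} → x ∈ xs → p x ≡ false → all p xs ≡ false
  all-false x∈xs px≡f = ≢true⇒false (λ h → true≢false (all-elim h x∈xs) px≡f)

  all-++ : ∀ xs ys → all p (xs ++ ys) ≡ all p xs ∧ all p ys
  all-++ []       ys = refl
  all-++ (x ∷ xs) ys = trans (cong (p x ∧_) (all-++ xs ys)) (sym (∧-assoc (p x) _ _))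

  all-cong : ∀ {q : A → Bool} xs → (∀ x → p x ≡ q x) → all p xs ≡ all q xs
  all-cong []       f = refl
  all-cong (x ∷ xs) f = cong₂ _∧_ (f x) (all-cong xs f)

  any-elim : ∀ xs → any p xs ≡ true → ∃ λ x → x ∈ xs × p x ≡ true
  any-elim xs h with find (any⁻ p xs (true⇒T h))
  ... | x , x∈xs , px = x , x∈xs , T⇒true px

  any-intro : ∀ {xs x} → x ∈ xs → p x ≡ true → any p xs ≡ true
  any-intro x∈xs px = T⇒true (any⁺ p (lose x∈xs (true⇒T px)))

_∩_ : ∀ {A : Set} → (A → Bool) → (A → Bool) → A → Bool
(p ∩ q) x = p x ∧ q x

consᵇ : ∀ {A : Set} → Bool → A → List A → List A
consᵇ b x xs = if b then x ∷ xs else xs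

module _ {A : Set} (p : A → Bool) where

  filterᵇ-∷ : ∀ x xs → filterᵇ p (x ∷ xs) ≡ consᵇ (p x) x (filterᵇ p xs)
  filterᵇ-∷ x xs with p x
  ... | true  = refl
  ... | false = refl

  filterᵇ-++ : ∀ xs ys → filterᵇ p (xs ++ ys) ≡ filterᵇ p xs ++ filterᵇ p ys
  filterᵇ-++ = List.filter-++ (T? ∘ p)

  ∈-filterᵇ⁻ : ∀ {x} xs → x ∈ filterᵇ p xs → x ∈ xs × p x ≡ true
  ∈-filterᵇ⁻ xs m with ∈.∈-filter⁻ (T? ∘ p) {xs = xs} m
  ... | x∈xs , px = x∈xs , T⇒true px

  ∈-filterᵇ⁺ : ∀ {x} xs → x ∈ xs → p x ≡ true → x ∈ filterᵇ p xs
  ∈-filterᵇ⁺ xs x∈xs px = ∈.∈-filter⁺ (T? ∘ p) x∈xs (true⇒T px)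

  filterᵇ-all : ∀ xs → (∀ {x} → x ∈ xs → p x ≡ true) → filterᵇ p xs ≡ xs
  filterᵇ-all xs f = List.filter-all (T? ∘ p) (All.tabulate (true⇒T ∘ f))

  filterᵇ-none : ∀ xs → (∀ {x} → x ∈ xs → p x ≡ false) → filterᵇ p xs ≡ []
  filterᵇ-none xs f = List.filter-none (T? ∘ p) (All.tabulate (λ m t → true≢false (T⇒true t) (f m)))

  filterᵇ-cong-∈ : ∀ {q : A → Bool} xs → (∀ {x} → x ∈ xs → p x ≡ q x) → filterᵇ p xs ≡ filterᵇ q xs
  filterᵇ-cong-∈         []       f = refl
  filterᵇ-cong-∈ {q = q} (x ∷ xs) f with p x | q x | f (here refl)
  ... | true  | true  | _ = cong (x ∷_) (filterᵇ-cong-∈ xs (f ∘ there))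
  ... | false | false | _ = filterᵇ-cong-∈ xs (f ∘ there)

  filterᵇ-filterᵇ : ∀ (q : A → Bool) xs → filterᵇ q (filterᵇ p xs) ≡ filterᵇ (p ∩ q) xs
  filterᵇ-filterᵇ q []       = refl
  filterᵇ-filterᵇ q (x ∷ xs) with p x
  ... | false = filterᵇ-filterᵇ q xs
  ... | true with q x
  ...   | true  = cong (x ∷_) (filterᵇ-filterᵇ q xs)
  ...   | false = filterᵇ-filterᵇ q xs

  filterᵇ-partition-↭ : ∀ xs → xs ↭ filterᵇ p xs ++ filterᵇ (not ∘ p) xs
  filterᵇ-partition-↭ []       = Perm.refl
  filterᵇ-partition-↭ (x ∷ xs) with p x
  ... | true  = Perm.prep x (filterᵇ-partition-↭ xs)
  ... | false = ↭-trans (Perm.prep x (filterᵇ-partition-↭ xs)) (↭-sym (↭.shift x (filterᵇ p xs) _))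

module _ {A B : Set} where

  filterᵇ-map : ∀ (p : B → Bool) (f : A → B) xs → filterᵇ p (map f xs) ≡ map f (filterᵇ (p ∘ f) xs)
  filterᵇ-map p f []       = refl
  filterᵇ-map p f (x ∷ xs) with p (f x)
  ... | true  = cong (f x ∷_) (filterᵇ-map p f xs)
  ... | false = filterᵇ-map p f xs

  filterᵇ-concatMap : ∀ (p : B → Bool) (f : A → List B) xs →
                      filterᵇ p (concatMap f xs) ≡ concatMap (filterᵇ p ∘ f) xs
  filterᵇ-concatMap p f []       = refl
  filterᵇ-concatMap p f (x ∷ xs) =
    trans (filterᵇ-++ p (f x) (concatMap f xs)) (cong (filterᵇ p (f x) ++_) (filterᵇ-concatMap p f xs))

  map-cong-∈ : ∀ {f g : A → B} xs → (∀ {x} → x ∈ xs → f x ≡ g x) → map f xs ≡ map g xs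
  map-cong-∈ xs f≡g = List.map-cong-local (All.tabulate f≡g)

module _ {A : Set} where

  unique-set⇒↭ : ∀ {xs ys : List A} → Unique xs → Unique ys → (∀ {x} → x ∈ xs ⇔ x ∈ ys) → xs ↭ ys
  unique-set⇒↭ uxs uys xs≈ys = ∼bag⇒↭ (unique∧set⇒bag uxs uys xs≈ys)

module _ {A B : Set} where

  ∈-concatMap⁻′ : ∀ (f : A → List B) xs {y} → y ∈ concatMap f xs → ∃ λ x → x ∈ xs × y ∈ f x
  ∈-concatMap⁻′ f xs y∈ = find (∈.∈-concatMap⁻ f {xs = xs} y∈)

  ∈-concatMap⁺′ : ∀ (f : A → List B) {xs x y} → x ∈ xs → y ∈ f x → y ∈ concatMap f xs
  ∈-concatMap⁺′ f x∈xs y∈fx = ∈.∈-concatMap⁺ f (lose x∈xs y∈fx)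

  Unique-map⁺-local : ∀ (f : A → B) {xs} → (∀ {x y} → x ∈ xs → y ∈ xs → f x ≡ f y → x ≡ y) →
                      Unique xs → Unique (map f xs)
  Unique-map⁺-local f {[]}     _   []            = []
  Unique-map⁺-local f {x ∷ xs} inj (x∉xs ∷ uniq) =
    All.tabulate fx∉ ∷ Unique-map⁺-local f (λ x∈ y∈ → inj (there x∈) (there y∈)) uniq
    where
    fx∉ : ∀ {z} → z ∈ map f xs → f x ≢ z
    fx∉ z∈ refl with ∈.∈-map⁻ f z∈
    ... | y , y∈xs , fx≡fy = All.lookup x∉xs y∈xs (inj (here refl) (there y∈xs) fx≡fy)

  Unique-concatMap⁺ : ∀ (f : A → List B) {xs} → Unique xs → (∀ {x} → x ∈ xs → Unique (f x)) →
                      (∀ {x y z} → x ∈ xs → y ∈ xs → x ≢ y → z ∈ f x → z ∉ f y) →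
                      Unique (concatMap f xs)
  Unique-concatMap⁺ f {[]}     _             _       _        = []
  Unique-concatMap⁺ f {x ∷ xs} (x∉xs ∷ uniq) uniqueF disjointF =
    Unique.++⁺ (uniqueF (here refl))
               (Unique-concatMap⁺ f uniq (uniqueF ∘ there) (λ x∈ y∈ → disjointF (there x∈) (there y∈)))
               separate
    where
    separate : ∀ {z} → z ∈ f x × z ∈ concatMap f xs → ⊥
    separate (z∈fx , z∈rest) with ∈-concatMap⁻′ f xs z∈rest
    ... | y , y∈xs , z∈fy = disjointF (here refl) (there y∈xs) (All.lookup x∉xs y∈xs) z∈fx z∈fy

module _ {A : Set} where

  Unique-++⁻ˡ : ∀ (xs : List A) {ys} → Unique (xs ++ ys) → Unique xs
  Unique-++⁻ˡ []       _             = []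
  Unique-++⁻ˡ (x ∷ xs) (x∉ ∷ uniq) =
    All.tabulate (λ y∈xs → All.lookup x∉ (∈.∈-++⁺ˡ y∈xs)) ∷ Unique-++⁻ˡ xs uniq

  Unique-∷ʳ⁻ : ∀ (xs : List A) {y} → Unique (xs ++ [ y ]) → y ∉ xs
  Unique-∷ʳ⁻ (x ∷ xs) (x∉ ∷ _)    (here refl) = All.lookup x∉ (∈.∈-++⁺ʳ xs (here refl)) refl
  Unique-∷ʳ⁻ (x ∷ xs) (_  ∷ uniq) (there y∈)  = Unique-∷ʳ⁻ xs uniq y∈

  Unique-∷ʳ⁺ : ∀ (xs : List A) {y} → Unique xs → y ∉ xs → Unique (xs ++ [ y ])
  Unique-∷ʳ⁺ xs uniq y∉xs = Unique.++⁺ uniq (All.[] ∷ []) (λ { (y∈xs , here refl) → y∉xs y∈xs })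

module _ {A : Set} (p q : A → Bool) (q⇒p : ∀ {x} → q x ≡ true → p x ≡ true) where

  length-filterᵇ-≤ : ∀ xs → length (filterᵇ q xs) ≤ length (filterᵇ p xs)
  length-filterᵇ-≤ []       = z≤n
  length-filterᵇ-≤ (x ∷ xs) with q x in qx
  ... | true rewrite q⇒p qx = s≤s (length-filterᵇ-≤ xs)
  ... | false with p x
  ...   | true  = m≤n⇒m≤1+n (length-filterᵇ-≤ xs)
  ...   | false = length-filterᵇ-≤ xs

  length-filterᵇ-< : ∀ xs {y} → y ∈ xs → p y ≡ true → q y ≡ false → length (filterᵇ q xs) < length (filterᵇ p xs)
  length-filterᵇ-< (x ∷ xs) (here refl) py qy rewrite py | qy = s≤s (length-filterᵇ-≤ xs)
  length-filterᵇ-< (x ∷ xs) (there y∈) py qy with q x in qx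
  ... | true rewrite q⇒p qx = s≤s (length-filterᵇ-< xs y∈ py qy)
  ... | false with p x
  ...   | true  = m≤n⇒m≤1+n (length-filterᵇ-< xs y∈ py qy)
  ...   | false = length-filterᵇ-< xs y∈ py qy

module _ {A : Set} where

  ++-injectiveˡ-length : ∀ (xs xs' : List A) {ys ys'} → xs ++ ys ≡ xs' ++ ys' → length xs ≡ length xs' → xs ≡ xs'
  ++-injectiveˡ-length []       []        _  _   = refl
  ++-injectiveˡ-length (x ∷ xs) (x' ∷ xs') eq len =
    cong₂ _∷_ (List.∷-injectiveˡ eq) (++-injectiveˡ-length xs xs' (List.∷-injectiveʳ eq) (suc-injective len))

  ++-∷-≢ : ∀ (xs : List A) {y ys} → xs ≢ xs ++ y ∷ ys
  ++-∷-≢ xs eq with () ← List.++-identityʳ-unique xs eq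

  isPrefixᵇ : DecidableEquality A → List A → List A → Bool
  isPrefixᵇ _≟_ []       _        = true
  isPrefixᵇ _≟_ (x ∷ xs) []       = false
  isPrefixᵇ _≟_ (x ∷ xs) (y ∷ ys) = does (x ≟ y) ∧ isPrefixᵇ _≟_ xs ys

  isPrefixᵇ-true⁻ : ∀ (_≟_ : DecidableEquality A) xs ys → isPrefixᵇ _≟_ xs ys ≡ true → ∃ λ zs → ys ≡ xs ++ zs
  isPrefixᵇ-true⁻ _≟_ []       ys       _ = ys , refl
  isPrefixᵇ-true⁻ _≟_ (x ∷ xs) (y ∷ ys) h with isPrefixᵇ-true⁻ _≟_ xs ys (∧-trueʳ {does (x ≟ y)} h)
  ... | zs , refl = zs , cong (_∷ xs ++ zs) (sym (does-true⁻ _≟_ (∧-trueˡ h)))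

  isPrefixᵇ-true⁺ : ∀ (_≟_ : DecidableEquality A) xs zs → isPrefixᵇ _≟_ xs (xs ++ zs) ≡ true
  isPrefixᵇ-true⁺ _≟_ []       zs = refl
  isPrefixᵇ-true⁺ _≟_ (x ∷ xs) zs = ∧-true⁺ (does-refl _≟_ x) (isPrefixᵇ-true⁺ _≟_ xs zs)

module _ {A : Set} where

  product-partition : ∀ (p : A → Bool) (f : A → ℕ) xs →
    product (map f xs) ≡ product (map f (filterᵇ p xs)) * product (map f (filterᵇ (not ∘ p) xs))
  product-partition p f xs = trans (product-↭ (↭.map⁺ f (filterᵇ-partition-↭ p xs)))
    (trans (cong product (List.map-++ f (filterᵇ p xs) _)) (product-++ (map f (filterᵇ p xs)) _))

  telescope : ∀ (h : List A → ℕ) (f g : A → ℕ) R us →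
    (∀ pre u post → us ≡ pre ++ u ∷ post → g u * h (R ++ pre) ≡ f u * h (R ++ pre ++ [ u ])) →
    product (map f us) * h (R ++ us) ≡ h R * product (map g us)
  telescope h f g R []         _    = trans (+-identityʳ _) (trans (cong h (List.++-identityʳ R)) (sym (*-identityʳ _)))
  telescope h f g R (u ∷ post) step = begin
    f u * product (map f post) * h (R ++ u ∷ post)
      ≡⟨ cong (λ X → f u * product (map f post) * h X) (sym (List.++-assoc R [ u ] post)) ⟩
    f u * product (map f post) * h ((R ++ [ u ]) ++ post)
      ≡⟨ *-assoc (f u) _ _ ⟩
    f u * (product (map f post) * h ((R ++ [ u ]) ++ post))
      ≡⟨ cong (f u *_) (telescope h f g (R ++ [ u ]) post step′) ⟩
    f u * (h (R ++ [ u ]) * product (map g post))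
      ≡⟨ sym (*-assoc (f u) _ _) ⟩
    f u * h (R ++ [ u ]) * product (map g post)
      ≡⟨ cong (_* product (map g post)) (sym (trans (cong (λ X → g u * h X) (sym (List.++-identityʳ R))) (step [] u post refl))) ⟩
    g u * h R * product (map g post)
      ≡⟨ trans (cong (_* product (map g post)) (*-comm (g u) (h R))) (*-assoc (h R) _ _) ⟩
    h R * (g u * product (map g post)) ∎
    where
    open ≡-Reasoning
    step′ : ∀ pre u′ post′ → post ≡ pre ++ u′ ∷ post′ →
            g u′ * h ((R ++ [ u ]) ++ pre) ≡ f u′ * h ((R ++ [ u ]) ++ pre ++ [ u′ ])
    step′ pre u′ post′ eq =
      subst₂ (λ X Y → g u′ * h X ≡ f u′ * h Y) (sym (List.++-assoc R [ u ] pre))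
             (sym (List.++-assoc R [ u ] (pre ++ [ u′ ]))) (step (u ∷ pre) u′ post′ (cong (u ∷_) eq))

  *-distribˡ-sum : ∀ c (f : A → ℕ) xs → c * sum (map f xs) ≡ sum (map (λ x → c * f x) xs)
  *-distribˡ-sum c f []       = *-zeroʳ c
  *-distribˡ-sum c f (x ∷ xs) = trans (*-distribˡ-+ c (f x) _) (cong (c * f x +_) (*-distribˡ-sum c f xs))

  *-distribʳ-sum : ∀ c (f : A → ℕ) xs → sum (map f xs) * c ≡ sum (map (λ x → f x * c) xs)
  *-distribʳ-sum c f []       = refl
  *-distribʳ-sum c f (x ∷ xs) = trans (*-distribʳ-+ c (f x) _) (cong (f x * c +_) (*-distribʳ-sum c f xs))

module SortBy {A : Set} {_<_ : Rel A 0ℓ} (<-sto : IsStrictTotalOrder _≡_ _<_) where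

  open IsStrictTotalOrder <-sto using (irrefl; asym)

  decTotalOrder : DecTotalOrder _ _ _
  decTotalOrder = record { isDecTotalOrder = StrictToNonStrict.isDecTotalOrder _≡_ _<_ <-sto }

  open Sort decTotalOrder public using (sort; sort-↭)

  sort-strict : ∀ xs → Unique xs → AllPairs _<_ (sort xs)
  sort-strict xs uniq = AllPairs.zipWith strict
    ( Sorted⇒AllPairs (DecTotalOrder.totalOrder decTotalOrder) (Sort.sort-↗ decTotalOrder xs)
    , ↭ₛ.Unique-resp-↭ (setoid A) (↭⇒↭ₛ (↭-sym (sort-↭ xs))) uniq )
    where
    strict : ∀ {x y} → (x < y ⊎ x ≡ y) × x ≢ y → x < y
    strict (inj₁ x<y , _)   = x<y
    strict (inj₂ x≡y , x≢y) = ⊥-elim (x≢y x≡y)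

  sorted-below : ∀ pre {u post x} → AllPairs _<_ (pre ++ u ∷ post) → x ∈ pre ++ u ∷ post → x < u ⇔ x ∈ pre
  sorted-below pre {u} {post} {x} sorted x∈ = mk⇔ to (from pre sorted)
    where
    from : ∀ pre → AllPairs _<_ (pre ++ u ∷ post) → x ∈ pre → x < u
    from (y ∷ pre) (y< ∷ _)      (here refl) = All.lookup y< (∈.∈-++⁺ʳ pre (here refl))
    from (y ∷ pre) (_  ∷ sorted) (there x∈)  = from pre sorted x∈
    after : ∀ pre → AllPairs _<_ (pre ++ u ∷ post) → x ∈ post → u < x
    after []        (u< ∷ _)      x∈ = All.lookup u< x∈
    after (y ∷ pre) (_  ∷ sorted) x∈ = after pre sorted x∈
    to : x < u → x ∈ pre
    to x<u with ∈.∈-++⁻ pre x∈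
    ... | inj₁ x∈pre         = x∈pre
    ... | inj₂ (here refl)   = ⊥-elim (irrefl refl x<u)
    ... | inj₂ (there x∈post) = ⊥-elim (asym x<u (after pre sorted x∈post))

-- Counting matchings

sublists-filterᵇ : ∀ {A : Set} (p : A → Bool) xs → sublists (filterᵇ p xs) ≡ filterᵇ (all p) (sublists xs)
sublists-filterᵇ p []       = refl
sublists-filterᵇ p (x ∷ xs) with p x in px
... | true = begin
    sublists (filterᵇ p xs) ++ map (x ∷_) (sublists (filterᵇ p xs))
      ≡⟨ cong (λ ys → ys ++ map (x ∷_) ys) (sublists-filterᵇ p xs) ⟩
    filterᵇ (all p) (sublists xs) ++ map (x ∷_) (filterᵇ (all p) (sublists xs))
      ≡⟨ cong (λ ys → filterᵇ (all p) (sublists xs) ++ map (x ∷_) ys)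
              (filterᵇ-cong-∈ (all p) (sublists xs) (λ {ys} _ → cong (_∧ all p ys) (sym px))) ⟩
    filterᵇ (all p) (sublists xs) ++ map (x ∷_) (filterᵇ (all p ∘ (x ∷_)) (sublists xs))
      ≡⟨ cong (filterᵇ (all p) (sublists xs) ++_) (sym (filterᵇ-map (all p) (x ∷_) (sublists xs))) ⟩
    filterᵇ (all p) (sublists xs) ++ filterᵇ (all p) (map (x ∷_) (sublists xs))
      ≡⟨ sym (filterᵇ-++ (all p) (sublists xs) _) ⟩
    filterᵇ (all p) (sublists xs ++ map (x ∷_) (sublists xs)) ∎
  where open ≡-Reasoning
... | false = begin
    sublists (filterᵇ p xs)
      ≡⟨ sublists-filterᵇ p xs ⟩
    filterᵇ (all p) (sublists xs)
      ≡⟨ sym (List.++-identityʳ _) ⟩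
    filterᵇ (all p) (sublists xs) ++ []
      ≡⟨ cong (filterᵇ (all p) (sublists xs) ++_) (sym (filterᵇ-none (all p) _ rejected)) ⟩
    filterᵇ (all p) (sublists xs) ++ filterᵇ (all p) (map (x ∷_) (sublists xs))
      ≡⟨ sym (filterᵇ-++ (all p) (sublists xs) _) ⟩
    filterᵇ (all p) (sublists xs ++ map (x ∷_) (sublists xs)) ∎
  where
  open ≡-Reasoning
  rejected : ∀ {ys} → ys ∈ map (x ∷_) (sublists xs) → all p ys ≡ false
  rejected m with ∈.∈-map⁻ (x ∷_) m
  ... | _ , _ , refl rewrite px = refl

module MatchingCount {V : Set} (_≟_ : DecidableEquality V) where

  open Matchings _≟_

  elem-true⁻ : ∀ {x ys} → elem x ys ≡ true → x ∈ ys
  elem-true⁻ {ys = ys} h with any-elim ys h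
  ... | y , y∈ys , x≟y rewrite does-true⁻ _≟_ x≟y = y∈ys

  elem-true⁺ : ∀ {x ys} → x ∈ ys → elem x ys ≡ true
  elem-true⁺ {x} x∈ys = any-intro x∈ys (does-refl _≟_ x)

  elem-false⁺ : ∀ {x ys} → x ∉ ys → elem x ys ≡ false
  elem-false⁺ x∉ys = ≢true⇒false (x∉ys ∘ elem-true⁻)

  disjoint-true⁻ : ∀ {xs ys x} → disjoint xs ys ≡ true → x ∈ xs → x ∉ ys
  disjoint-true⁻ h x∈xs x∈ys = true≢false (elem-true⁺ x∈ys) (not-true⁻ (all-elim h x∈xs))

  disjoint-true⁺ : ∀ xs ys → (∀ {x} → x ∈ xs → x ∉ ys) → disjoint xs ys ≡ true
  disjoint-true⁺ xs ys f = all-intro xs (not-true⁺ ∘ elem-false⁺ ∘ f)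

  disjoint-false⁺ : ∀ {xs ys x} → x ∈ xs → x ∈ ys → disjoint xs ys ≡ false
  disjoint-false⁺ x∈xs x∈ys = ≢true⇒false (λ h → disjoint-true⁻ h x∈xs x∈ys)

  disjoint-sym : ∀ xs ys → disjoint xs ys ≡ disjoint ys xs
  disjoint-sym xs ys = true⇔⇒≡
    (λ h → disjoint-true⁺ ys xs (λ y∈ys y∈xs → disjoint-true⁻ h y∈xs y∈ys))
    (λ h → disjoint-true⁺ xs ys (λ x∈xs x∈ys → disjoint-true⁻ h x∈ys x∈xs))

  #matchings-∷ : ∀ e E → #matchings (e ∷ E) ≡ #matchings E + #matchings (filterᵇ (disjoint e) E)
  #matchings-∷ e E = begin
    length (filterᵇ isMatching (sublists E ++ map (e ∷_) (sublists E)))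
      ≡⟨ cong length (filterᵇ-++ isMatching (sublists E) _) ⟩
    length (filterᵇ isMatching (sublists E) ++ filterᵇ isMatching (map (e ∷_) (sublists E)))
      ≡⟨ List.length-++ (filterᵇ isMatching (sublists E)) ⟩
    #matchings E + length (filterᵇ isMatching (map (e ∷_) (sublists E)))
      ≡⟨ cong (λ Ms → #matchings E + length Ms) (filterᵇ-map isMatching (e ∷_) (sublists E)) ⟩
    #matchings E + length (map (e ∷_) (filterᵇ (all (disjoint e) ∩ isMatching) (sublists E)))
      ≡⟨ cong (#matchings E +_) (List.length-map (e ∷_) (filterᵇ (all (disjoint e) ∩ isMatching) (sublists E))) ⟩
    #matchings E + length (filterᵇ (all (disjoint e) ∩ isMatching) (sublists E))
      ≡⟨ cong (λ Ms → #matchings E + length Ms) (sym (filterᵇ-filterᵇ (all (disjoint e)) isMatching (sublists E))) ⟩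
    #matchings E + length (filterᵇ isMatching (filterᵇ (all (disjoint e)) (sublists E)))
      ≡⟨ cong (λ Ms → #matchings E + length (filterᵇ isMatching Ms)) (sym (sublists-filterᵇ (disjoint e) E)) ⟩
    #matchings E + #matchings (filterᵇ (disjoint e) E) ∎
    where open ≡-Reasoning

  #matchings-∷-filterᵇ : ∀ q e E →
    #matchings (e ∷ filterᵇ q E) ≡ #matchings (filterᵇ q E) + #matchings (filterᵇ (q ∩ disjoint e) E)
  #matchings-∷-filterᵇ q e E =
    trans (#matchings-∷ e (filterᵇ q E)) (cong (#matchings (filterᵇ q E) +_) (cong #matchings (filterᵇ-filterᵇ q (disjoint e) E)))

  #avoiding-#matchings : ∀ E u → #avoiding E u ≡ #matchings (filterᵇ (not ∘ elem u) E)
  #avoiding-#matchings E u = begin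
    length (filterᵇ (avoids u) (filterᵇ isMatching (sublists E)))
      ≡⟨ cong length (filterᵇ-filterᵇ isMatching (avoids u) (sublists E)) ⟩
    length (filterᵇ (isMatching ∩ avoids u) (sublists E))
      ≡⟨ cong length (filterᵇ-cong-∈ _ (sublists E) (λ {M} _ → ∧-comm (isMatching M) (avoids u M))) ⟩
    length (filterᵇ (avoids u ∩ isMatching) (sublists E))
      ≡⟨ cong length (sym (filterᵇ-filterᵇ (avoids u) isMatching (sublists E))) ⟩
    length (filterᵇ isMatching (filterᵇ (avoids u) (sublists E)))
      ≡⟨ cong (length ∘ filterᵇ isMatching) (sym (sublists-filterᵇ (not ∘ elem u) E)) ⟩
    #matchings (filterᵇ (not ∘ elem u) E) ∎
    where open ≡-Reasoning

  -- Invariance is proved for every filtered list at once, since #matchings (e ∷ E) involves E filtered by e.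
  private
    FilteredInvariant : List (List V) → List (List V) → Set
    FilteredInvariant E E' = ∀ q → #matchings (filterᵇ q E) ≡ #matchings (filterᵇ q E')

    cons-step : ∀ e {E E'} → FilteredInvariant E E' → ∀ q →
                #matchings (e ∷ filterᵇ q E) ≡ #matchings (e ∷ filterᵇ q E')
    cons-step e {E} {E'} inv q = begin
      #matchings (e ∷ filterᵇ q E)
        ≡⟨ #matchings-∷-filterᵇ q e E ⟩
      #matchings (filterᵇ q E) + #matchings (filterᵇ (q ∩ disjoint e) E)
        ≡⟨ cong₂ _+_ (inv q) (inv (q ∩ disjoint e)) ⟩
      #matchings (filterᵇ q E') + #matchings (filterᵇ (q ∩ disjoint e) E')
        ≡⟨ sym (#matchings-∷-filterᵇ q e E') ⟩
      #matchings (e ∷ filterᵇ q E') ∎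
      where open ≡-Reasoning

    #both : (List V → Bool) → List V → List V → List (List V) → ℕ
    #both q e f E = if disjoint e f then #matchings (filterᵇ ((q ∩ disjoint e) ∩ disjoint f) E) else 0

    #matchings-∷-∷ : ∀ q e f E →
      #matchings (e ∷ f ∷ filterᵇ q E) ≡
      #matchings (filterᵇ q E) + #matchings (filterᵇ (q ∩ disjoint f) E)
        + (#matchings (filterᵇ (q ∩ disjoint e) E) + #both q e f E)
    #matchings-∷-∷ q e f E = begin
      #matchings (e ∷ f ∷ filterᵇ q E)
        ≡⟨ #matchings-∷ e (f ∷ filterᵇ q E) ⟩
      #matchings (f ∷ filterᵇ q E) + #matchings (filterᵇ (disjoint e) (f ∷ filterᵇ q E))
        ≡⟨ cong₂ _+_ (#matchings-∷-filterᵇ q f E) (cong #matchings (filterᵇ-∷ (disjoint e) f _)) ⟩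
      m q + m (q ∩ disjoint f) + #matchings (consᵇ (disjoint e f) f (filterᵇ (disjoint e) (filterᵇ q E)))
        ≡⟨ cong (λ F → m q + m (q ∩ disjoint f) + #matchings (consᵇ (disjoint e f) f F))
                (filterᵇ-filterᵇ q (disjoint e) E) ⟩
      m q + m (q ∩ disjoint f) + #matchings (consᵇ (disjoint e f) f (filterᵇ (q ∩ disjoint e) E))
        ≡⟨ cong (m q + m (q ∩ disjoint f) +_) (second-edge (disjoint e f)) ⟩
      m q + m (q ∩ disjoint f) + (m (q ∩ disjoint e) + #both q e f E) ∎
      where
      open ≡-Reasoning
      m : (List V → Bool) → ℕ
      m r = #matchings (filterᵇ r E)
      second-edge : ∀ b → #matchings (consᵇ b f (filterᵇ (q ∩ disjoint e) E)) ≡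
                          m (q ∩ disjoint e) + (if b then m ((q ∩ disjoint e) ∩ disjoint f) else 0)
      second-edge true  = #matchings-∷-filterᵇ (q ∩ disjoint e) f E
      second-edge false = sym (+-identityʳ (m (q ∩ disjoint e)))

    #both-swap : ∀ q e f {E E'} → FilteredInvariant E E' → #both q e f E ≡ #both q f e E'
    #both-swap q e f {E} inv rewrite disjoint-sym e f with disjoint f e
    ... | false = refl
    ... | true  = trans (cong #matchings (filterᵇ-cong-∈ _ E (λ {g} _ → ∧-swap (q g))))
                        (inv ((q ∩ disjoint f) ∩ disjoint e))
      where
      ∧-swap : ∀ a {b c} → (a ∧ b) ∧ c ≡ (a ∧ c) ∧ b
      ∧-swap a {b} {c} = trans (∧-assoc a b c) (trans (cong (a ∧_) (∧-comm b c)) (sym (∧-assoc a c b)))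

    swap-step : ∀ q e f {E E'} → FilteredInvariant E E' →
                #matchings (e ∷ f ∷ filterᵇ q E) ≡ #matchings (f ∷ e ∷ filterᵇ q E')
    swap-step q e f {E} {E'} inv = begin
      #matchings (e ∷ f ∷ filterᵇ q E)
        ≡⟨ #matchings-∷-∷ q e f E ⟩
      m q + m (q ∩ disjoint f) + (m (q ∩ disjoint e) + #both q e f E)
        ≡⟨ cong₂ _+_ (cong₂ _+_ (inv q) (inv (q ∩ disjoint f)))
                     (cong₂ _+_ (inv (q ∩ disjoint e)) (#both-swap q e f {E} {E'} inv)) ⟩
      m′ q + m′ (q ∩ disjoint f) + (m′ (q ∩ disjoint e) + #both q f e E')
        ≡⟨ interchange (m′ q) (m′ (q ∩ disjoint f)) (m′ (q ∩ disjoint e)) (#both q f e E') ⟩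
      m′ q + m′ (q ∩ disjoint e) + (m′ (q ∩ disjoint f) + #both q f e E')
        ≡⟨ sym (#matchings-∷-∷ q f e E') ⟩
      #matchings (f ∷ e ∷ filterᵇ q E') ∎
      where
      open ≡-Reasoning
      m m′ : (List V → Bool) → ℕ
      m  r = #matchings (filterᵇ r E)
      m′ r = #matchings (filterᵇ r E')
      interchange : ∀ a b c d → a + b + (c + d) ≡ a + c + (b + d)
      interchange = solve-∀

    swap-consᵇ : ∀ q e f {E E'} → FilteredInvariant E E' →
                 #matchings (consᵇ (q e) e (consᵇ (q f) f (filterᵇ q E))) ≡
                 #matchings (consᵇ (q f) f (consᵇ (q e) e (filterᵇ q E')))
    swap-consᵇ q e f {E} {E'} inv with q e | q f
    ... | true  | true  = swap-step q e f {E} {E'} inv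
    ... | true  | false = cons-step e {E} {E'} inv q
    ... | false | true  = cons-step f {E} {E'} inv q
    ... | false | false = inv q

  #matchings-filterᵇ-↭ : ∀ {E E'} → E ↭ E' → ∀ q → #matchings (filterᵇ q E) ≡ #matchings (filterᵇ q E')
  #matchings-filterᵇ-↭ Perm.refl          q = refl
  #matchings-filterᵇ-↭ (Perm.trans p p')  q = trans (#matchings-filterᵇ-↭ p q) (#matchings-filterᵇ-↭ p' q)
  #matchings-filterᵇ-↭ {e ∷ E} {e ∷ E'} (Perm.prep e p) q with q e
  ... | true  = cons-step e {E} {E'} (#matchings-filterᵇ-↭ p) q
  ... | false = #matchings-filterᵇ-↭ p q
  #matchings-filterᵇ-↭ {e ∷ f ∷ E} {f ∷ e ∷ E'} (Perm.swap e f p) q = begin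
    #matchings (filterᵇ q (e ∷ f ∷ E))
      ≡⟨ cong #matchings (trans (filterᵇ-∷ q e _) (cong (consᵇ (q e) e) (filterᵇ-∷ q f E))) ⟩
    #matchings (consᵇ (q e) e (consᵇ (q f) f (filterᵇ q E)))
      ≡⟨ swap-consᵇ q e f {E} {E'} (#matchings-filterᵇ-↭ p) ⟩
    #matchings (consᵇ (q f) f (consᵇ (q e) e (filterᵇ q E')))
      ≡⟨ cong #matchings (sym (trans (filterᵇ-∷ q f _) (cong (consᵇ (q f) f) (filterᵇ-∷ q e E')))) ⟩
    #matchings (filterᵇ q (f ∷ e ∷ E')) ∎
    where open ≡-Reasoning

  #matchings-↭ : ∀ {E E'} → E ↭ E' → #matchings E ≡ #matchings E'
  #matchings-↭ {E} {E'} p = begin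
    #matchings E                        ≡⟨ cong #matchings (sym (filterᵇ-all (λ _ → true) E (λ _ → refl))) ⟩
    #matchings (filterᵇ (λ _ → true) E)  ≡⟨ #matchings-filterᵇ-↭ p (λ _ → true) ⟩
    #matchings (filterᵇ (λ _ → true) E') ≡⟨ cong #matchings (filterᵇ-all (λ _ → true) E' (λ _ → refl)) ⟩
    #matchings E' ∎
    where open ≡-Reasoning

  VertexDisjoint : List (List V) → List (List V) → Set
  VertexDisjoint E₁ E₂ = ∀ {e f} → e ∈ E₁ → f ∈ E₂ → disjoint e f ≡ true

  private
    #matchings-filterᵇ-++ : ∀ q E₁ E₂ → VertexDisjoint E₁ E₂ →
      #matchings (filterᵇ q E₁ ++ E₂) ≡ #matchings (filterᵇ q E₁) * #matchings E₂
    #matchings-filterᵇ-++ q []       E₂ _  = sym (+-identityʳ (#matchings E₂))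
    #matchings-filterᵇ-++ q (e ∷ E₁) E₂ E₁∥E₂ with q e
    ... | false = #matchings-filterᵇ-++ q E₁ E₂ (E₁∥E₂ ∘ there)
    ... | true  = begin
      #matchings (e ∷ (filterᵇ q E₁ ++ E₂))
        ≡⟨ #matchings-∷ e (filterᵇ q E₁ ++ E₂) ⟩
      #matchings (filterᵇ q E₁ ++ E₂) + #matchings (filterᵇ (disjoint e) (filterᵇ q E₁ ++ E₂))
        ≡⟨ cong (λ F → #matchings (filterᵇ q E₁ ++ E₂) + #matchings F) restrict ⟩
      #matchings (filterᵇ q E₁ ++ E₂) + #matchings (filterᵇ (q ∩ disjoint e) E₁ ++ E₂)
        ≡⟨ cong₂ _+_ (#matchings-filterᵇ-++ q E₁ E₂ (E₁∥E₂ ∘ there))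
                     (#matchings-filterᵇ-++ (q ∩ disjoint e) E₁ E₂ (E₁∥E₂ ∘ there)) ⟩
      #matchings (filterᵇ q E₁) * #matchings E₂ + #matchings (filterᵇ (q ∩ disjoint e) E₁) * #matchings E₂
        ≡⟨ sym (*-distribʳ-+ (#matchings E₂) (#matchings (filterᵇ q E₁)) _) ⟩
      (#matchings (filterᵇ q E₁) + #matchings (filterᵇ (q ∩ disjoint e) E₁)) * #matchings E₂
        ≡⟨ cong (_* #matchings E₂) (sym (#matchings-∷-filterᵇ q e E₁)) ⟩
      #matchings (e ∷ filterᵇ q E₁) * #matchings E₂ ∎
      where
      open ≡-Reasoning
      restrict : filterᵇ (disjoint e) (filterᵇ q E₁ ++ E₂) ≡ filterᵇ (q ∩ disjoint e) E₁ ++ E₂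
      restrict = trans (filterᵇ-++ (disjoint e) (filterᵇ q E₁) E₂)
                       (cong₂ _++_ (filterᵇ-filterᵇ q (disjoint e) E₁)
                                   (filterᵇ-all (disjoint e) E₂ (E₁∥E₂ (here refl))))

  #matchings-++ : ∀ E₁ E₂ → VertexDisjoint E₁ E₂ → #matchings (E₁ ++ E₂) ≡ #matchings E₁ * #matchings E₂
  #matchings-++ E₁ E₂ E₁∥E₂ =
    subst (λ F → #matchings (F ++ E₂) ≡ #matchings F * #matchings E₂)
          (filterᵇ-all (λ _ → true) E₁ (λ _ → refl))
          (#matchings-filterᵇ-++ (λ _ → true) E₁ E₂ E₁∥E₂)

  #matchings-concatMap : ∀ {X : Set} (S : X → List (List V)) xs → Unique xs →
    (∀ {x y} → x ∈ xs → y ∈ xs → x ≢ y → VertexDisjoint (S x) (S y)) →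
    #matchings (concatMap S xs) ≡ product (map (#matchings ∘ S) xs)
  #matchings-concatMap S []       _             _        = refl
  #matchings-concatMap S (x ∷ xs) (x∉xs ∷ uniq) disjointS =
    trans (#matchings-++ (S x) (concatMap S xs) x∥xs)
          (cong (#matchings (S x) *_) (#matchings-concatMap S xs uniq (λ y z → disjointS (there y) (there z))))
    where
    x∥xs : VertexDisjoint (S x) (concatMap S xs)
    x∥xs e∈Sx f∈Sxs with ∈.∈-concat⁻′ (map S xs) f∈Sxs
    ... | F , f∈F , F∈ with ∈.∈-map⁻ S F∈
    ... | y , y∈xs , refl = disjointS (here refl) (there y∈xs) (All.lookup x∉xs y∈xs) e∈Sx f∈F

  -- a matching either avoids x or contains exactly one edge through x
  #matchings-by-vertex : ∀ x E →
    #matchings E ≡ #matchings (filterᵇ (not ∘ elem x) E)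
                   + sum (map (λ f → #matchings (filterᵇ (disjoint f) E)) (filterᵇ (elem x) E))
  #matchings-by-vertex x E = begin
    #matchings E
      ≡⟨ #matchings-↭ (filterᵇ-partition-↭ (elem x) E) ⟩
    #matchings (Eₓ ++ E₋ₓ)
      ≡⟨ through-x Eₓ (λ f∈ → proj₂ (∈-filterᵇ⁻ (elem x) E f∈)) ⟩
    #matchings E₋ₓ + sum (map (λ f → #matchings (filterᵇ (disjoint f) E₋ₓ)) Eₓ)
      ≡⟨ cong (λ ns → #matchings E₋ₓ + sum ns) (map-cong-∈ Eₓ (sym ∘ restrict)) ⟩
    #matchings E₋ₓ + sum (map (λ f → #matchings (filterᵇ (disjoint f) E)) Eₓ) ∎
    where
    open ≡-Reasoning
    Eₓ E₋ₓ : List (List V)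
    Eₓ  = filterᵇ (elem x) E
    E₋ₓ = filterᵇ (not ∘ elem x) E

    through-x : ∀ F → (∀ {f} → f ∈ F → elem x f ≡ true) →
      #matchings (F ++ E₋ₓ) ≡ #matchings E₋ₓ + sum (map (λ f → #matchings (filterᵇ (disjoint f) E₋ₓ)) F)
    through-x []      _   = sym (+-identityʳ (#matchings E₋ₓ))
    through-x (f ∷ F) x∈F = begin
      #matchings (f ∷ (F ++ E₋ₓ))
        ≡⟨ #matchings-∷ f (F ++ E₋ₓ) ⟩
      #matchings (F ++ E₋ₓ) + #matchings (filterᵇ (disjoint f) (F ++ E₋ₓ))
        ≡⟨ cong₂ _+_ (through-x F (x∈F ∘ there)) (cong #matchings drop-F) ⟩
      #matchings E₋ₓ + rest + #matchings (filterᵇ (disjoint f) E₋ₓ)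
        ≡⟨ +-assoc (#matchings E₋ₓ) rest _ ⟩
      #matchings E₋ₓ + (rest + #matchings (filterᵇ (disjoint f) E₋ₓ))
        ≡⟨ cong (#matchings E₋ₓ +_) (+-comm rest _) ⟩
      #matchings E₋ₓ + (#matchings (filterᵇ (disjoint f) E₋ₓ) + rest) ∎
      where
      rest : ℕ
      rest = sum (map (λ f → #matchings (filterᵇ (disjoint f) E₋ₓ)) F)
      drop-F : filterᵇ (disjoint f) (F ++ E₋ₓ) ≡ filterᵇ (disjoint f) E₋ₓ
      drop-F = trans (filterᵇ-++ (disjoint f) F E₋ₓ)
                     (cong (_++ filterᵇ (disjoint f) E₋ₓ)
                           (filterᵇ-none (disjoint f) F (λ {g} g∈F →
                              disjoint-false⁺ (elem-true⁻ {x} {f} (x∈F (here refl))) (elem-true⁻ {x} {g} (x∈F (there g∈F))))))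

    restrict : ∀ {f} → f ∈ Eₓ → #matchings (filterᵇ (disjoint f) E) ≡ #matchings (filterᵇ (disjoint f) E₋ₓ)
    restrict {f} f∈Eₓ = begin
      #matchings (filterᵇ (disjoint f) E)
        ≡⟨ #matchings-filterᵇ-↭ (filterᵇ-partition-↭ (elem x) E) (disjoint f) ⟩
      #matchings (filterᵇ (disjoint f) (Eₓ ++ E₋ₓ))
        ≡⟨ cong #matchings (filterᵇ-++ (disjoint f) Eₓ E₋ₓ) ⟩
      #matchings (filterᵇ (disjoint f) Eₓ ++ filterᵇ (disjoint f) E₋ₓ)
        ≡⟨ cong (λ F → #matchings (F ++ filterᵇ (disjoint f) E₋ₓ))
                (filterᵇ-none (disjoint f) Eₓ (λ g∈ → disjoint-false⁺ (x∈ f∈Eₓ) (x∈ g∈))) ⟩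
      #matchings (filterᵇ (disjoint f) E₋ₓ) ∎
      where
      x∈ : ∀ {g} → g ∈ Eₓ → x ∈ g
      x∈ {g} g∈ = elem-true⁻ {x} {g} (proj₂ (∈-filterᵇ⁻ (elem x) E g∈))

-- Conflict-free walks

module Walks {k : ℕ} (H : KGraph k) {_≺_ : Rel (Fin (n H)) 0ℓ} (≺-sto : IsStrictTotalOrder _≡_ _≺_) where

  Vertex Edge : Set
  Vertex = Fin (n H)
  Edge   = Subset (n H)

  end : Vertex → Walk H → Vertex
  end = endpoint H ≺-sto

  conflictSet : Vertex → Edge → Vertex → List Vertex
  conflictSet = C H ≺-sto

  isCF : Vertex → Walk H → Bool
  isCF = isCFWalk H ≺-sto

  avoidsAll : Edge → List Vertex → Bool
  avoidsAll e R = all (not ∘ lookup e) R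

  conflictsFrom : Vertex → Walk H → List Vertex → List Vertex
  conflictsFrom prev []             R = R
  conflictsFrom prev ((e , w) ∷ ws) R = conflictsFrom w ws (R ++ conflictSet prev e w)

  conflicts : Vertex → Walk H → List Vertex
  conflicts v W = conflictsFrom v W []

  end-++ : ∀ prev ws ws' → end prev (ws ++ ws') ≡ end (end prev ws) ws'
  end-++ prev []             ws' = refl
  end-++ prev ((e , w) ∷ ws) ws' = end-++ w ws ws'

  conflictsFrom-++ : ∀ prev ws ws' R →
    conflictsFrom prev (ws ++ ws') R ≡ conflictsFrom (end prev ws) ws' (conflictsFrom prev ws R)
  conflictsFrom-++ prev []             ws' R = refl
  conflictsFrom-++ prev ((e , w) ∷ ws) ws' R = conflictsFrom-++ w ws ws' _

  conflictFree-++ : ∀ prev ws ws' R →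
    conflictFree H ≺-sto prev (ws ++ ws') R ≡
    conflictFree H ≺-sto prev ws R ∧ conflictFree H ≺-sto (end prev ws) ws' (conflictsFrom prev ws R)
  conflictFree-++ prev []             ws' R = refl
  conflictFree-++ prev ((e , w) ∷ ws) ws' R
    rewrite conflictFree-++ w ws ws' (R ++ conflictSet prev e w) = sym (∧-assoc (avoidsAll e R) _ _)

  consecutive-++ : ∀ prev ws ws' →
    consecutive H prev (ws ++ ws') ≡ consecutive H prev ws ∧ consecutive H (end prev ws) ws'
  consecutive-++ prev []             ws' = refl
  consecutive-++ prev ((e , w) ∷ ws) ws' rewrite consecutive-++ w ws ws' =
    trans (cong (lookup e prev ∧_) (sym (∧-assoc (lookup e w) _ _))) (sym (∧-assoc (lookup e prev) _ _))

  end-∷ʳ : ∀ prev W e u → end prev (W ++ [ (e , u) ]) ≡ u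
  end-∷ʳ prev W e u = end-++ prev W _

  conflicts-∷ʳ : ∀ v W e u → conflicts v (W ++ [ (e , u) ]) ≡ conflicts v W ++ conflictSet (end v W) e u
  conflicts-∷ʳ v W e u = conflictsFrom-++ v W _ []

  conflictsFrom-⊇ : ∀ prev ws R {x} → x ∈ R → x ∈ conflictsFrom prev ws R
  conflictsFrom-⊇ prev []             R x∈R = x∈R
  conflictsFrom-⊇ prev ((e , w) ∷ ws) R x∈R = conflictsFrom-⊇ w ws _ (∈.∈-++⁺ˡ x∈R)

  -- since v_{i-1} ∈ C_i
  vertex-end-or-conflict : ∀ prev ws R {x} → x ∈ prev ∷ map proj₂ ws →
                           x ≡ end prev ws ⊎ x ∈ conflictsFrom prev ws R
  vertex-end-or-conflict prev []             R (here refl) = inj₁ refl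
  vertex-end-or-conflict prev ((e , w) ∷ ws) R (here refl) =
    inj₂ (conflictsFrom-⊇ w ws _ (∈.∈-++⁺ʳ R (here refl)))
  vertex-end-or-conflict prev ((e , w) ∷ ws) R (there x∈) = vertex-end-or-conflict w ws _ x∈

  edge-meets-conflicts : ∀ prev ws R {e'} → consecutive H prev ws ≡ true → e' ∈ map proj₁ ws →
                         ∃ λ x → x ∈ conflictsFrom prev ws R × lookup e' x ≡ true
  edge-meets-conflicts prev ((e , w) ∷ ws) R linked (here refl) =
    prev , conflictsFrom-⊇ w ws _ (∈.∈-++⁺ʳ R (here refl)) , ∧-trueˡ linked
  edge-meets-conflicts prev ((e , w) ∷ ws) R linked (there e'∈) =
    edge-meets-conflicts w ws _ (∧-trueʳ {lookup e w} (∧-trueʳ {lookup e prev} linked)) e'∈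

  module _ {A : Set} (_≟_ : DecidableEquality A) where

    private
      all≢-true⁻ : ∀ x xs → all (λ y → not (does (x ≟ y))) xs ≡ true → All.All (x ≢_) xs
      all≢-true⁻ x xs h = All.tabulate (λ y∈ x≡y → true≢false (all-elim h y∈)
                                         (cong not (subst (λ y → does (x ≟ y) ≡ true) x≡y (does-refl _≟_ x))))

      all≢-true⁺ : ∀ x xs → All.All (x ≢_) xs → all (λ y → not (does (x ≟ y))) xs ≡ true
      all≢-true⁺ x xs x∉ = all-intro xs (λ y∈ → not-true⁺ (does-false⁺ _≟_ (All.lookup x∉ y∈)))

    allDistinct-true⁻ : ∀ xs → allDistinct H _≟_ xs ≡ true → Unique xs
    allDistinct-true⁻ []       _ = []
    allDistinct-true⁻ (x ∷ xs) h =
      all≢-true⁻ x xs (∧-trueˡ h) ∷ allDistinct-true⁻ xs (∧-trueʳ {all (λ y → not (does (x ≟ y))) xs} h)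

    allDistinct-true⁺ : ∀ xs → Unique xs → allDistinct H _≟_ xs ≡ true
    allDistinct-true⁺ []       _             = refl
    allDistinct-true⁺ (x ∷ xs) (x∉xs ∷ uniq) = ∧-true⁺ (all≢-true⁺ x xs x∉xs) (allDistinct-true⁺ xs uniq)

  isEdge-true⁻ : ∀ e → isEdge H e ≡ true → e ∈ edges H
  isEdge-true⁻ e h with any-elim (edges H) h
  ... | f , f∈ , e≟f = subst (_∈ edges H) (sym (does-true⁻ subset-≟ e≟f)) f∈

  isEdge-true⁺ : ∀ {e} → e ∈ edges H → isEdge H e ≡ true
  isEdge-true⁺ {e} e∈ = any-intro e∈ (does-refl subset-≟ e)

  record IsCF (v : Vertex) (W : Walk H) : Set where
    field
      distinctVertices : Unique (v ∷ map proj₂ W)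
      distinctEdges    : Unique (map proj₁ W)
      edgesOfH         : all (isEdge H) (map proj₁ W) ≡ true
      linked           : consecutive H v W ≡ true
      noConflict       : conflictFree H ≺-sto v W [] ≡ true

  isCF-true⁻ : ∀ v W → isCF v W ≡ true → IsCF v W
  isCF-true⁻ v W h = record
    { distinctVertices = allDistinct-true⁻ Fin._≟_ _ (∧-trueˡ path)
    ; distinctEdges    = allDistinct-true⁻ subset-≟ _ (∧-trueˡ path₁)
    ; edgesOfH         = ∧-trueˡ path₂
    ; linked           = ∧-trueʳ {all (isEdge H) (map proj₁ W)} path₂
    ; noConflict       = ∧-trueʳ {isBergePath H v W} h
    }
    where
    path : isBergePath H v W ≡ true
    path = ∧-trueˡ h
    path₁ : allDistinct H subset-≟ (map proj₁ W) ∧ all (isEdge H) (map proj₁ W) ∧ consecutive H v W ≡ true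
    path₁ = ∧-trueʳ {allDistinct H Fin._≟_ (v ∷ map proj₂ W)} path
    path₂ : all (isEdge H) (map proj₁ W) ∧ consecutive H v W ≡ true
    path₂ = ∧-trueʳ {allDistinct H subset-≟ (map proj₁ W)} path₁

  isCF-true⁺ : ∀ v W → IsCF v W → isCF v W ≡ true
  isCF-true⁺ v W cf = ∧-true⁺ (∧-true⁺ (allDistinct-true⁺ Fin._≟_ _ distinctVertices)
                                (∧-true⁺ (allDistinct-true⁺ subset-≟ _ distinctEdges) (∧-true⁺ edgesOfH linked)))
                              noConflict
    where open IsCF cf

  record Extension (v : Vertex) (W : Walk H) (e : Edge) (u : Vertex) : Set where
    field
      edgeOfH      : e ∈ edges H
      containsEnd  : lookup e (end v W) ≡ true
      containsU    : lookup e u ≡ true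
      u≢end        : u ≢ end v W
      avoidsConflicts : avoidsAll e (conflicts v W) ≡ true

  isCF-∷ʳ⁻ : ∀ v W e u → isCF v (W ++ [ (e , u) ]) ≡ true → isCF v W ≡ true × Extension v W e u
  isCF-∷ʳ⁻ v W e u h =
    isCF-true⁺ v W record
      { distinctVertices = Unique-++⁻ˡ (v ∷ map proj₂ W) vertices
      ; distinctEdges    = Unique-++⁻ˡ (map proj₁ W) edgesUnique
      ; edgesOfH         = ∧-trueˡ inH
      ; linked           = ∧-trueˡ linked′
      ; noConflict       = ∧-trueˡ noConflict′
      } ,
    record
      { edgeOfH         = isEdge-true⁻ e (∧-trueˡ (∧-trueʳ {all (isEdge H) (map proj₁ W)} inH))
      ; containsEnd     = ∧-trueˡ lastLink
      ; containsU       = ∧-trueˡ (∧-trueʳ {lookup e (end v W)} lastLink)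
      ; u≢end           = λ u≡end → Unique-∷ʳ⁻ (v ∷ map proj₂ W) vertices
                            (subst (_∈ v ∷ map proj₂ W) (sym u≡end) (end∈ v W))
      ; avoidsConflicts = ∧-trueˡ (∧-trueʳ {conflictFree H ≺-sto v W []} noConflict′)
      }
    where
    open IsCF (isCF-true⁻ v (W ++ [ (e , u) ]) h)
    end∈ : ∀ prev ws → end prev ws ∈ prev ∷ map proj₂ ws
    end∈ prev []             = here refl
    end∈ prev ((_ , w) ∷ ws) = there (end∈ w ws)
    vertices : Unique ((v ∷ map proj₂ W) ++ [ u ])
    vertices = subst (Unique ∘ (v ∷_)) (List.map-++ proj₂ W _) distinctVertices
    edgesUnique : Unique (map proj₁ W ++ [ e ])
    edgesUnique = subst Unique (List.map-++ proj₁ W _) distinctEdges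
    inH : all (isEdge H) (map proj₁ W) ∧ all (isEdge H) [ e ] ≡ true
    inH = trans (sym (all-++ (map proj₁ W) [ e ])) (subst (λ es → all (isEdge H) es ≡ true) (List.map-++ proj₁ W _) edgesOfH)
    linked′ : consecutive H v W ∧ consecutive H (end v W) [ (e , u) ] ≡ true
    linked′ = trans (sym (consecutive-++ v W _)) linked
    lastLink : consecutive H (end v W) [ (e , u) ] ≡ true
    lastLink = ∧-trueʳ {consecutive H v W} linked′
    noConflict′ : conflictFree H ≺-sto v W [] ∧ conflictFree H ≺-sto (end v W) [ (e , u) ] (conflicts v W) ≡ true
    noConflict′ = trans (sym (conflictFree-++ v W _ [])) noConflict

  isCF-∷ʳ⁺ : ∀ v W e u → isCF v W ≡ true → Extension v W e u → isCF v (W ++ [ (e , u) ]) ≡ true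
  isCF-∷ʳ⁺ v W e u h ext = isCF-true⁺ v (W ++ [ (e , u) ]) record
    { distinctVertices = subst (Unique ∘ (v ∷_)) (sym (List.map-++ proj₂ W _))
                               (Unique-∷ʳ⁺ (v ∷ map proj₂ W) distinctVertices u∉)
    ; distinctEdges    = subst Unique (sym (List.map-++ proj₁ W _)) (Unique-∷ʳ⁺ (map proj₁ W) distinctEdges e∉)
    ; edgesOfH         = subst (λ es → all (isEdge H) es ≡ true) (sym (List.map-++ proj₁ W _))
                               (trans (all-++ (map proj₁ W) [ e ]) (∧-true⁺ edgesOfH (∧-true⁺ (isEdge-true⁺ edgeOfH) refl)))
    ; linked           = trans (consecutive-++ v W _) (∧-true⁺ linked (∧-true⁺ containsEnd (∧-true⁺ containsU refl)))
    ; noConflict       = trans (conflictFree-++ v W _ []) (∧-true⁺ noConflict (∧-true⁺ avoidsConflicts refl))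
    }
    where
    open IsCF (isCF-true⁻ v W h)
    open Extension ext
    outside : ∀ {y} → lookup e y ≡ true → y ∉ conflicts v W
    outside e∋y y∈ = true≢false e∋y (not-true⁻ (all-elim avoidsConflicts y∈))
    u∉ : u ∉ v ∷ map proj₂ W
    u∉ u∈ with vertex-end-or-conflict v W [] u∈
    ... | inj₁ u≡end = u≢end u≡end
    ... | inj₂ u∈R   = outside containsU u∈R
    e∉ : e ∉ map proj₁ W
    e∉ e∈ with edge-meets-conflicts v W [] linked e∈
    ... | y , y∈R , e∋y = outside e∋y y∈R

  isCF-prefix : ∀ v W W' → isCF v (W ++ W') ≡ true → isCF v W ≡ true
  isCF-prefix v W []       h = subst (λ W → isCF v W ≡ true) (List.++-identityʳ W) h
  isCF-prefix v W (s ∷ W') h = proj₁ (isCF-∷ʳ⁻ v W (proj₁ s) (proj₂ s)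
    (isCF-prefix v (W ++ [ s ]) W' (subst (λ W → isCF v W ≡ true) (sym (List.++-assoc W [ s ] W')) h)))

  ∈-members⁻ : ∀ (e : Edge) {x} → x ∈ members e → lookup e x ≡ true
  ∈-members⁻ e x∈ = proj₂ (∈-filterᵇ⁻ (lookup e) (allFin (n H)) x∈)

  ∈-members⁺ : ∀ (e : Edge) {x} → lookup e x ≡ true → x ∈ members e
  ∈-members⁺ e {x} e∋x = ∈-filterᵇ⁺ (lookup e) (allFin (n H)) (∈.∈-allFin x) e∋x

  Unique-members : ∀ (e : Edge) → Unique (members e)
  Unique-members e = Unique.filter⁺ _ (Unique.allFin⁺ _)

  elem-members : ∀ (e : Edge) x → Matchings.elem Fin._≟_ x (members e) ≡ lookup e x
  elem-members e x = true⇔⇒≡ (∈-members⁻ e ∘ elem-true⁻ {x} {members e}) (elem-true⁺ ∘ ∈-members⁺ e)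
    where open MatchingCount (Fin._≟_ {n H})

  others : Vertex → Walk H → Edge → List Vertex
  others v W e = filterᵇ (λ u → not (does (u Fin.≟ end v W))) (members e)

  child : Walk H → Edge → Vertex → Walk H
  child W e u = W ++ [ (e , u) ]

  ∈-others⁻ : ∀ v W e {u} → u ∈ others v W e → lookup e u ≡ true × u ≢ end v W
  ∈-others⁻ v W e u∈ with ∈-filterᵇ⁻ _ (members e) u∈
  ... | u∈e , u≢ = ∈-members⁻ e u∈e , does-false⁻ Fin._≟_ (not-true⁻ u≢)

  ∈-others⁺ : ∀ v W e {u} → lookup e u ≡ true → u ≢ end v W → u ∈ others v W e
  ∈-others⁺ v W e e∋u u≢end = ∈-filterᵇ⁺ _ (members e) (∈-members⁺ e e∋u) (not-true⁺ (does-false⁺ Fin._≟_ u≢end))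

  child-injective : ∀ W {e e' u u'} → child W e u ≡ child W e' u' → (e , u) ≡ (e' , u')
  child-injective W eq = List.∷-injectiveˡ (List.++-cancelˡ W _ _ eq)

  ∈-conflictSet⁻ : ∀ w e u {x} → x ∈ conflictSet w e u →
                   x ≡ w ⊎ (lookup e x ≡ true × x ≢ w × x ≢ u × x ≺ u)
  ∈-conflictSet⁻ w e u (here refl) = inj₁ refl
  ∈-conflictSet⁻ w e u {x} (there x∈) with ∈-filterᵇ⁻ _ (allFin (n H)) x∈
  ... | _ , h = inj₂ (∧-trueˡ h , does-false⁻ Fin._≟_ (not-true⁻ (∧-trueˡ h₁))
                    , does-false⁻ Fin._≟_ (not-true⁻ (∧-trueˡ h₂)) , x≺u (∧-trueʳ {not (does (x Fin.≟ u))} h₂))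
    where
    h₁ : not (does (x Fin.≟ w)) ∧ not (does (x Fin.≟ u)) ∧ does (IsStrictTotalOrder._<?_ ≺-sto x u) ≡ true
    h₁ = ∧-trueʳ {lookup e x} h
    h₂ : not (does (x Fin.≟ u)) ∧ does (IsStrictTotalOrder._<?_ ≺-sto x u) ≡ true
    h₂ = ∧-trueʳ {not (does (x Fin.≟ w))} h₁
    x≺u : does (IsStrictTotalOrder._<?_ ≺-sto x u) ≡ true → x ≺ u
    x≺u _ with IsStrictTotalOrder._<?_ ≺-sto x u
    ... | yes x≺u = x≺u

  ∈-conflictSet⁺ : ∀ w e u {x} → lookup e x ≡ true → x ≢ w → x ≢ u → x ≺ u → x ∈ conflictSet w e u
  ∈-conflictSet⁺ w e u {x} e∋x x≢w x≢u x≺u = there (∈-filterᵇ⁺ _ (allFin (n H)) (∈.∈-allFin x)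
    (∧-true⁺ e∋x (∧-true⁺ (not-true⁺ (does-false⁺ Fin._≟_ x≢w))
                         (∧-true⁺ (not-true⁺ (does-false⁺ Fin._≟_ x≢u)) decided))))
    where
    decided : does (IsStrictTotalOrder._<?_ ≺-sto x u) ≡ true
    decided with IsStrictTotalOrder._<?_ ≺-sto x u
    ... | yes _   = refl
    ... | no x⊀u = ⊥-elim (x⊀u x≺u)

  end∉conflicts : ∀ v W → isCF v W ≡ true → end v W ∉ conflicts v W
  end∉conflicts v W h with initLast W
  end∉conflicts v .[]                    h | []                   = λ ()
  end∉conflicts v .(W′ ++ [ (e , u) ]) h | W′ ∷ʳ′ (e , u) = λ u∈ →
    u∉ (subst₂ _∈_ (end-∷ʳ v W′ e u) (conflicts-∷ʳ v W′ e u) u∈)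
    where
    open Extension (proj₂ (isCF-∷ʳ⁻ v W′ e u h))
    u∉ : u ∉ conflicts v W′ ++ conflictSet (end v W′) e u
    u∉ u∈ with ∈.∈-++⁻ (conflicts v W′) u∈
    ... | inj₁ u∈R = true≢false containsU (not-true⁻ (all-elim avoidsConflicts u∈R))
    ... | inj₂ u∈C with ∈-conflictSet⁻ (end v W′) e u u∈C
    ...   | inj₁ u≡end              = u≢end u≡end
    ...   | inj₂ (_ , _ , u≢u , _) = u≢u refl

  isTreeEdge-char : ∀ v W e → isCF v W ≡ true → e ∈ edges H →
                    isTreeEdge H ≺-sto v W e ≡ lookup e (end v W) ∧ avoidsAll e (conflicts v W)
  isTreeEdge-char v W e h e∈H with lookup e (end v W) in e∋end
  ... | false = refl
  ... | true  = true⇔⇒≡ avoiding extending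
    where
    extending : avoidsAll e (conflicts v W) ≡ true → all (isCF v) (extensions H ≺-sto v W e) ≡ true
    extending avoids = all-intro _ λ c∈ → case-child (∈.∈-map⁻ (child W e) c∈)
      where
      case-child : ∀ {c} → ∃ (λ u → u ∈ others v W e × c ≡ child W e u) → isCF v c ≡ true
      case-child (u , u∈ , refl) = isCF-∷ʳ⁺ v W e u h record
        { edgeOfH = e∈H ; containsEnd = e∋end ; containsU = proj₁ (∈-others⁻ v W e u∈)
        ; u≢end = proj₂ (∈-others⁻ v W e u∈) ; avoidsConflicts = avoids }

    -- a vertex of e in the conflicts is not the end of W, so it ends one of the extensions
    avoiding : all (isCF v) (extensions H ≺-sto v W e) ≡ true → avoidsAll e (conflicts v W) ≡ true
    avoiding all-cf = all-intro _ λ {x} x∈R → not-true⁺ (outside x x∈R (lookup e x) refl)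
      where
      outside : ∀ x → x ∈ conflicts v W → ∀ b → lookup e x ≡ b → lookup e x ≡ false
      outside x x∈R false e∌x = e∌x
      outside x x∈R true  e∋x with x Fin.≟ end v W
      ... | yes refl  = ⊥-elim (end∉conflicts v W h x∈R)
      ... | no  x≢end = ⊥-elim (true≢false e∋x (not-true⁻ (all-elim avoids x∈R)))
        where
        avoids : avoidsAll e (conflicts v W) ≡ true
        avoids = Extension.avoidsConflicts (proj₂ (isCF-∷ʳ⁻ v W e x
                   (all-elim all-cf (∈.∈-map⁺ (child W e) (∈-others⁺ v W e e∋x x≢end)))))

  Subset-ext : ∀ {e e' : Edge} → (∀ x → lookup e x ≡ lookup e' x) → e ≡ e'
  Subset-ext {e} {e'} f = trans (sym (VecP.tabulate∘lookup e)) (trans (VecP.tabulate-cong f) (VecP.tabulate∘lookup e'))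

  -- an edge through the end of W is determined by its other vertices
  extensions-injective : ∀ v W {e e'} → lookup e (end v W) ≡ true → lookup e' (end v W) ≡ true →
                         extensions H ≺-sto v W e ≡ extensions H ≺-sto v W e' → e ≡ e'
  extensions-injective v W {e} {e'} e∋end e'∋end eq with others v W e in eqe | others v W e' in eqe'
  ... | u ∷ _  | u' ∷ _ = cong proj₁ (child-injective W (List.∷-injectiveˡ eq))
  ... | []     | []     = Subset-ext λ x → true⇔⇒≡ (same e e' x e'∋end eqe) (same e' e x e∋end eqe')
    where
    same : ∀ a b x → lookup b (end v W) ≡ true → others v W a ≡ [] → lookup a x ≡ true → lookup b x ≡ true
    same a b x b∋end none a∋x with x Fin.≟ end v W
    ... | yes refl  = b∋end
    ... | no  x≢end with () ← subst (x ∈_) none (∈-others⁺ v W a a∋x x≢end)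

  edgesAvoiding : List Vertex → List Edge
  edgesAvoiding R = filterᵇ (λ e → avoidsAll e R) (edges H)

  edgesAvoiding-[] : edgesAvoiding [] ≡ edges H
  edgesAvoiding-[] = filterᵇ-all _ (edges H) (λ _ → refl)

  -- the edge of a step contains its first vertex, which joins the conflicts
  edgesAvoiding-step : ∀ R prev e w → e ∈ edges H → avoidsAll e R ≡ true → lookup e prev ≡ true →
                       length (edgesAvoiding (R ++ conflictSet prev e w)) < length (edgesAvoiding R)
  edgesAvoiding-step R prev e w e∈H avoids e∋prev =
    length-filterᵇ-< (λ f → avoidsAll f R) (λ f → avoidsAll f (R ++ conflictSet prev e w))
      (λ {f} h → ∧-trueˡ (trans (sym (all-++ R (conflictSet prev e w))) h))
      (edges H) e∈H avoids (all-false (∈.∈-++⁺ʳ R (here refl)) (cong not e∋prev))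

  length≤edgesAvoiding : ∀ prev ws R → consecutive H prev ws ≡ true → conflictFree H ≺-sto prev ws R ≡ true →
    all (isEdge H) (map proj₁ ws) ≡ true → length ws + length (edgesAvoiding (conflictsFrom prev ws R)) ≤ length (edgesAvoiding R)
  length≤edgesAvoiding prev []             R _ _ _ = ≤-refl
  length≤edgesAvoiding prev ((e , w) ∷ ws) R linked noConflict inH =
    ≤-trans (s≤s (length≤edgesAvoiding w ws (R ++ conflictSet prev e w)
                    (∧-trueʳ {lookup e w} (∧-trueʳ {lookup e prev} linked))
                    (∧-trueʳ {avoidsAll e R} noConflict) (∧-trueʳ {isEdge H e} inH)))
            (edgesAvoiding-step R prev e w (isEdge-true⁻ e (∧-trueˡ inH)) (∧-trueˡ noConflict) (∧-trueˡ linked))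

  length-isCF : ∀ v W → isCF v W ≡ true → length W ≤ length (edges H)
  length-isCF v W h = ≤-trans (m≤m+n (length W) _)
    (subst (length W + length (edgesAvoiding (conflicts v W)) ≤_) (cong length edgesAvoiding-[])
           (length≤edgesAvoiding v W [] linked noConflict edgesOfH))
    where open IsCF (isCF-true⁻ v W h)

  ∈-listsUpTo : ∀ {A : Set} (as : List A) L W → All.All (_∈ as) W → length W ≤ L → W ∈ listsUpTo H ≺-sto as L
  ∈-listsUpTo as zero    []      _              _         = here refl
  ∈-listsUpTo as (suc L) []      _              _         = here refl
  ∈-listsUpTo as (suc L) (s ∷ W) (s∈ All.∷ W⊆) (s≤s len) =
    there (∈-concatMap⁺′ (λ a → map (a ∷_) (listsUpTo H ≺-sto as L)) s∈ (∈.∈-map⁺ (s ∷_) (∈-listsUpTo as L W W⊆ len)))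

  Unique-listsUpTo : ∀ {A : Set} (as : List A) L → Unique as → Unique (listsUpTo H ≺-sto as L)
  Unique-listsUpTo as zero    _    = All.[] ∷ []
  Unique-listsUpTo as (suc L) uniq =
    All.tabulate (λ x∈ []≡x → []∉ (subst (_∈ _) (sym []≡x) x∈)) ∷
    Unique-concatMap⁺ (λ a → map (a ∷_) (listsUpTo H ≺-sto as L)) uniq
      (λ _ → Unique.map⁺ List.∷-injectiveʳ (Unique-listsUpTo as L uniq))
      (λ _ _ a≢b z∈a z∈b → a≢b (same-head z∈a z∈b))
    where
    same-head : ∀ {a b z} → z ∈ map (a ∷_) (listsUpTo H ≺-sto as L) → z ∈ map (b ∷_) (listsUpTo H ≺-sto as L) → a ≡ b
    same-head z∈a z∈b with ∈.∈-map⁻ _ z∈a | ∈.∈-map⁻ _ z∈b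
    ... | _ , _ , refl | _ , _ , eq = List.∷-injectiveˡ eq
    []∉ : [] ∉ concatMap (λ a → map (a ∷_) (listsUpTo H ≺-sto as L)) as
    []∉ []∈ with ∈-concatMap⁻′ _ as []∈
    ... | a , _ , []∈a with ∈.∈-map⁻ (a ∷_) []∈a
    ... | _ , _ , ()

  ∈-alphabet : ∀ {e} u → e ∈ edges H → (e , u) ∈ alphabet H ≺-sto
  ∈-alphabet {e} u e∈H = ∈-concatMap⁺′ (λ e → map (e ,_) (allFin (n H))) e∈H (∈.∈-map⁺ (e ,_) (∈.∈-allFin u))

  Unique-alphabet : Unique (alphabet H ≺-sto)
  Unique-alphabet = Unique-concatMap⁺ _ (distinct H)
    (λ _ → Unique.map⁺ (cong proj₂) (Unique.allFin⁺ (n H)))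
    (λ _ _ e≢f z∈e z∈f → e≢f (same-edge z∈e z∈f))
    where
    same-edge : ∀ {e f z} → z ∈ map (e ,_) (allFin (n H)) → z ∈ map (f ,_) (allFin (n H)) → e ≡ f
    same-edge z∈e z∈f with ∈.∈-map⁻ _ z∈e | ∈.∈-map⁻ _ z∈f
    ... | _ , _ , refl | _ , _ , eq = cong proj₁ eq

  steps∈alphabet : ∀ W → all (isEdge H) (map proj₁ W) ≡ true → All.All (_∈ alphabet H ≺-sto) W
  steps∈alphabet []            _   = All.[]
  steps∈alphabet ((e , u) ∷ W) inH =
    ∈-alphabet u (isEdge-true⁻ e (∧-trueˡ inH)) All.∷ steps∈alphabet W (∧-trueʳ {isEdge H e} inH)

-- The walk tree

module WalkTree {k : ℕ} (H : KGraph k) {_≺_ : Rel (Fin (n H)) 0ℓ} (≺-sto : IsStrictTotalOrder _≡_ _≺_) (v : Fin (n H)) where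

  open Walks H ≺-sto

  ext : Walk H → Edge → List (Walk H)
  ext = extensions H ≺-sto v

  isTreeEdgeAt : Walk H → Edge → Bool
  isTreeEdgeAt = isTreeEdge H ≺-sto v

  private
    edgesAt : Walk H → Edge → List (List (Walk H))
    edgesAt W₀ e = if isTreeEdgeAt W₀ e then [ W₀ ∷ ext W₀ e ] else []

    ∈-if⁻ : ∀ {A : Set} b {x y : A} → y ∈ (if b then [ x ] else []) → b ≡ true × y ≡ x
    ∈-if⁻ true (here y≡x) = refl , y≡x

    Unique-if : ∀ {A : Set} b {x : A} → Unique (if b then [ x ] else [])
    Unique-if true  = All.[] ∷ []
    Unique-if false = []

  record TreeEdgeShape (f : List (Walk H)) : Set where
    field
      base      : Walk H
      edge      : Edge
      base-cf   : isCF v base ≡ true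
      edgeOfH   : edge ∈ edges H
      treeEdge  : isTreeEdgeAt base edge ≡ true
      shape     : f ≡ base ∷ ext base edge

  -- kept abstract so that type checking never unfolds the enumerations walkTreeVertices and walkTreeEdges
  abstract
    treeVertices : List (Walk H)
    treeVertices = walkTreeVertices H ≺-sto v

    treeEdges : List (List (Walk H))
    treeEdges = walkTreeEdges H ≺-sto v

    treeEdges-def : treeEdges ≡ walkTreeEdges H ≺-sto v
    treeEdges-def = refl

    ∈-treeVertices⁺ : ∀ W → isCF v W ≡ true → W ∈ treeVertices
    ∈-treeVertices⁺ W h = ∈-filterᵇ⁺ (isCF v) _
      (∈-listsUpTo (alphabet H ≺-sto) (length (edges H)) W (steps∈alphabet W (IsCF.edgesOfH (isCF-true⁻ v W h)))
                   (length-isCF v W h)) h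

    ∈-treeVertices⁻ : ∀ {W} → W ∈ treeVertices → isCF v W ≡ true
    ∈-treeVertices⁻ W∈ = proj₂ (∈-filterᵇ⁻ (isCF v) (listsUpTo H ≺-sto (alphabet H ≺-sto) (length (edges H))) W∈)

    Unique-treeVertices : Unique treeVertices
    Unique-treeVertices = Unique.filter⁺ _ (Unique-listsUpTo (alphabet H ≺-sto) (length (edges H)) Unique-alphabet)

    ∈-treeEdges⁻ : ∀ {f} → f ∈ treeEdges → TreeEdgeShape f
    ∈-treeEdges⁻ f∈ with ∈-concatMap⁻′ (λ W₀ → concatMap (edgesAt W₀) (edges H)) treeVertices f∈
    ... | W₀ , W₀∈ , f∈W₀ with ∈-concatMap⁻′ (edgesAt W₀) (edges H) f∈W₀
    ... | e , e∈H , f∈e with ∈-if⁻ (isTreeEdgeAt W₀ e) f∈e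
    ... | isTree , refl = record { base = W₀ ; edge = e ; base-cf = ∈-treeVertices⁻ W₀∈ ; edgeOfH = e∈H
                                 ; treeEdge = isTree ; shape = refl }

    ∈-treeEdges⁺ : ∀ W₀ e → isCF v W₀ ≡ true → e ∈ edges H → isTreeEdgeAt W₀ e ≡ true → W₀ ∷ ext W₀ e ∈ treeEdges
    ∈-treeEdges⁺ W₀ e h e∈H isTree =
      ∈-concatMap⁺′ (λ W₀ → concatMap (edgesAt W₀) (edges H)) (∈-treeVertices⁺ W₀ h)
        (∈-concatMap⁺′ (edgesAt W₀) e∈H
          (subst (λ b → W₀ ∷ ext W₀ e ∈ (if b then [ W₀ ∷ ext W₀ e ] else [])) (sym isTree) (here refl)))

    Unique-treeEdges : Unique treeEdges
    Unique-treeEdges = Unique-concatMap⁺ _ Unique-treeVertices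
      (λ _ → Unique-concatMap⁺ _ (distinct H) (λ {e} _ → Unique-if (isTreeEdgeAt _ e))
                               (λ _ _ e≢e' f∈ f∈' → e≢e' (same-edge f∈ f∈')))
      (λ _ _ W≢W' f∈ f∈' → W≢W' (same-base f∈ f∈'))
      where
      same-edge : ∀ {W₀ e e' f} → f ∈ edgesAt W₀ e → f ∈ edgesAt W₀ e' → e ≡ e'
      same-edge {W₀} {e} {e'} f∈ f∈' with ∈-if⁻ (isTreeEdgeAt W₀ e) f∈ | ∈-if⁻ (isTreeEdgeAt W₀ e') f∈'
      ... | isTree , refl | isTree' , eq =
        extensions-injective v W₀ (∧-trueˡ isTree) (∧-trueˡ isTree') (List.∷-injectiveʳ eq)
      starts-with : ∀ {W₀ f} → f ∈ concatMap (edgesAt W₀) (edges H) → ∃ λ r → f ≡ W₀ ∷ r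
      starts-with {W₀} f∈ with ∈-concatMap⁻′ (edgesAt W₀) (edges H) f∈
      ... | e , _ , f∈e with ∈-if⁻ (isTreeEdgeAt W₀ e) f∈e
      ... | _ , refl = _ , refl
      same-base : ∀ {W₀ W₀' f} → f ∈ concatMap (edgesAt W₀) (edges H) → f ∈ concatMap (edgesAt W₀') (edges H) → W₀ ≡ W₀'
      same-base f∈ f∈' with starts-with f∈ | starts-with f∈'
      ... | _ , refl | _ , eq = List.∷-injectiveˡ eq

  baseOf : List (Walk H) → Walk H
  baseOf []      = []
  baseOf (W ∷ _) = W

  subtree : Walk H → List (List (Walk H))
  subtree W = filterᵇ (isPrefixᵇ (step-≟ H) W ∘ baseOf) treeEdges

  roots : Walk H → List Edge
  roots W = filterᵇ (isTreeEdgeAt W) (edges H)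

  children : Walk H → List (Walk H)
  children W = concatMap (ext W) (roots W)

  ∈-subtree⁻ : ∀ W {f} → f ∈ subtree W → f ∈ treeEdges × ∃ λ r → baseOf f ≡ W ++ r
  ∈-subtree⁻ W {f} f∈ with ∈-filterᵇ⁻ (isPrefixᵇ (step-≟ H) W ∘ baseOf) treeEdges f∈
  ... | f∈T , prefix = f∈T , isPrefixᵇ-true⁻ (step-≟ H) W (baseOf f) prefix

  ∈-subtree⁺ : ∀ W {f} r → f ∈ treeEdges → baseOf f ≡ W ++ r → f ∈ subtree W
  ∈-subtree⁺ W {f} r f∈T eq = ∈-filterᵇ⁺ _ treeEdges f∈T
    (subst (λ X → isPrefixᵇ (step-≟ H) W X ≡ true) (sym eq) (isPrefixᵇ-true⁺ (step-≟ H) W r))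

  subtree-[]≡treeEdges : subtree [] ≡ walkTreeEdges H ≺-sto v
  subtree-[]≡treeEdges = trans (filterᵇ-all _ treeEdges (λ _ → refl)) treeEdges-def

  Unique-subtree : ∀ W → Unique (subtree W)
  Unique-subtree W = Unique.filter⁺ _ Unique-treeEdges

  treeEdge-vertex : ∀ {f x} → f ∈ treeEdges → x ∈ f → x ≡ baseOf f ⊎ ∃ λ s → x ≡ baseOf f ++ [ s ]
  treeEdge-vertex f∈ x∈ with ∈-treeEdges⁻ f∈
  treeEdge-vertex f∈ (here refl) | record { shape = refl } = inj₁ refl
  treeEdge-vertex f∈ (there x∈)  | record { edge = e ; shape = refl } with ∈.∈-map⁻ (child _ e) x∈
  ... | u , _ , refl = inj₂ ((e , u) , refl)

  treeEdge-vertex-extends : ∀ {f x} → f ∈ treeEdges → x ∈ f → ∃ λ r → x ≡ baseOf f ++ r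
  treeEdge-vertex-extends f∈ x∈ with treeEdge-vertex f∈ x∈
  ... | inj₁ refl       = [] , sym (List.++-identityʳ _)
  ... | inj₂ (s , refl) = [ s ] , refl

  subtree-vertex-extends : ∀ W {f x} → f ∈ subtree W → x ∈ f → ∃ λ r → x ≡ W ++ r
  subtree-vertex-extends W f∈ x∈ with ∈-subtree⁻ W f∈
  ... | f∈T , r₀ , eq with treeEdge-vertex-extends f∈T x∈
  ... | r₁ , refl = r₀ ++ r₁ , trans (cong (_++ r₁) eq) (List.++-assoc W r₀ r₁)

  Unique-roots : ∀ W → Unique (roots W)
  Unique-roots W = Unique.filter⁺ _ (distinct H)

  Unique-ext : ∀ W e → Unique (ext W e)
  Unique-ext W e = Unique.map⁺ (cong proj₂ ∘ child-injective W) (Unique.filter⁺ _ (Unique-members e))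

  ∈-children⁻ : ∀ W {c} → c ∈ children W → ∃ λ e → ∃ λ u → e ∈ roots W × u ∈ others v W e × c ≡ child W e u
  ∈-children⁻ W c∈ with ∈-concatMap⁻′ (ext W) (roots W) c∈
  ... | e , e∈ , c∈e with ∈.∈-map⁻ (child W e) c∈e
  ... | u , u∈ , eq = e , u , e∈ , u∈ , eq

  Unique-children : ∀ W → Unique (children W)
  Unique-children W = Unique-concatMap⁺ (ext W) (Unique-roots W) (λ _ → Unique-ext W _)
    (λ _ _ e≢e' c∈ c∈' → e≢e' (same-edge c∈ c∈'))
    where
    same-edge : ∀ {e e' c} → c ∈ ext W e → c ∈ ext W e' → e ≡ e'
    same-edge c∈ c∈' with ∈.∈-map⁻ _ c∈ | ∈.∈-map⁻ _ c∈'
    ... | _ , _ , refl | _ , _ , eq = cong proj₁ (child-injective W eq)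

  length-children : ∀ W {c} → c ∈ children W → length c ≡ suc (length W)
  length-children W c∈ with ∈-children⁻ W c∈
  ... | _ , _ , _ , _ , refl = trans (List.length-++ W) (+-comm (length W) 1)

  open Matchings (walk-≟ H) using (elem; disjoint)
  open MatchingCount (walk-≟ H) using (elem-true⁻; elem-true⁺; elem-false⁺; disjoint-true⁺; disjoint-true⁻)

  roots-contain-end : ∀ W {e} → e ∈ roots W → lookup e (end v W) ≡ true
  roots-contain-end W e∈ = ∧-trueˡ (proj₂ (∈-filterᵇ⁻ (isTreeEdgeAt W) (edges H) e∈))

  rootEdge : Walk H → Edge → List (Walk H)
  rootEdge W e = W ∷ ext W e

  subtree-through-root-↭ : ∀ W → isCF v W ≡ true → filterᵇ (elem W) (subtree W) ↭ map (rootEdge W) (roots W)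
  subtree-through-root-↭ W h = unique-set⇒↭ (Unique.filter⁺ _ (Unique-subtree W))
    (Unique-map⁺-local (rootEdge W)
      (λ e∈ e'∈ eq → extensions-injective v W (roots-contain-end W e∈) (roots-contain-end W e'∈) (List.∷-injectiveʳ eq))
      (Unique-roots W))
    (mk⇔ to from)
    where
    to : ∀ {f} → f ∈ filterᵇ (elem W) (subtree W) → f ∈ map (rootEdge W) (roots W)
    to {f} f∈ with ∈-filterᵇ⁻ (elem W) (subtree W) f∈
    ... | f∈S , W∈f with ∈-subtree⁻ W f∈S
    ... | f∈T , r , base≡ with treeEdge-vertex f∈T (elem-true⁻ {W} {f} W∈f)
    ... | inj₂ (s , W≡) with () ← List.++-conicalʳ r [ s ] (List.++-identityʳ-unique W
                                     (trans W≡ (trans (cong (_++ [ s ]) base≡) (List.++-assoc W r [ s ]))))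
    ... | inj₁ W≡base with ∈-treeEdges⁻ f∈T
    ... | record { base = W₀ ; edge = e ; edgeOfH = e∈H ; treeEdge = isTree ; shape = refl } =
      subst (λ X → X ∷ ext X e ∈ map (rootEdge W) (roots W)) W≡base
        (∈.∈-map⁺ (rootEdge W) (∈-filterᵇ⁺ (isTreeEdgeAt W) (edges H) e∈H
                                 (subst (λ X → isTreeEdgeAt X e ≡ true) (sym W≡base) isTree)))

    from : ∀ {f} → f ∈ map (rootEdge W) (roots W) → f ∈ filterᵇ (elem W) (subtree W)
    from f∈ with ∈.∈-map⁻ (rootEdge W) f∈
    ... | e , e∈ , refl with ∈-filterᵇ⁻ (isTreeEdgeAt W) (edges H) e∈
    ... | e∈H , isTree = ∈-filterᵇ⁺ (elem W) (subtree W)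
      (∈-subtree⁺ W [] (∈-treeEdges⁺ W e h e∈H isTree) (sym (List.++-identityʳ W)))
      (elem-true⁺ {W} {rootEdge W e} (here refl))

  baseOf∈ : ∀ {f} → f ∈ treeEdges → baseOf f ∈ f
  baseOf∈ f∈ with ∈-treeEdges⁻ f∈
  ... | record { shape = refl } = here refl

  baseOf-cf : ∀ {f} → f ∈ treeEdges → isCF v (baseOf f) ≡ true
  baseOf-cf f∈ with ∈-treeEdges⁻ f∈
  ... | record { base-cf = h ; shape = refl } = h

  child∈children : ∀ W e u → isCF v W ≡ true → isCF v (child W e u) ≡ true → child W e u ∈ children W
  child∈children W e u h h′ = ∈-concatMap⁺′ (ext W) e∈roots (∈.∈-map⁺ (child W e) (∈-others⁺ v W e containsU u≢end))
    where
    open Extension (proj₂ (isCF-∷ʳ⁻ v W e u h′))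
    e∈roots : e ∈ roots W
    e∈roots = ∈-filterᵇ⁺ (isTreeEdgeAt W) (edges H) edgeOfH
                (trans (isTreeEdge-char v W e h edgeOfH) (∧-true⁺ containsEnd avoidsConflicts))

  -- two children of W are walks of the same length, so no walk extends both
  children-separate : ∀ W {c c' x} → c ∈ children W → c' ∈ children W →
                      (∃ λ r → x ≡ c ++ r) → (∃ λ r' → x ≡ c' ++ r') → c ≡ c'
  children-separate W {c} {c'} c∈ c'∈ (r , refl) (r' , eq) =
    ++-injectiveˡ-length c c' eq (trans (length-children W c∈) (sym (length-children W c'∈)))

  subtree-disjoint : ∀ W {c c' f f'} → c ∈ children W → c' ∈ children W → c ≢ c' →
                     f ∈ subtree c → f' ∈ subtree c' → disjoint f f' ≡ true
  subtree-disjoint W {c} {c'} {f} {f'} c∈ c'∈ c≢c' f∈ f'∈ = disjoint-true⁺ f f' λ x∈f x∈f' →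
    c≢c' (children-separate W c∈ c'∈ (subtree-vertex-extends c f∈ x∈f) (subtree-vertex-extends c' f'∈ x∈f'))

  subtree-below-root-↭ : ∀ W → isCF v W ≡ true → filterᵇ (not ∘ elem W) (subtree W) ↭ concatMap subtree (children W)
  subtree-below-root-↭ W h = unique-set⇒↭ (Unique.filter⁺ _ (Unique-subtree W))
    (Unique-concatMap⁺ subtree (Unique-children W) (λ {c} _ → Unique-subtree c)
      (λ {c} {c'} c∈ c'∈ c≢c' f∈ f∈' → c≢c' (children-separate W c∈ c'∈
         (subtree-vertex-extends c f∈ (baseOf∈ (proj₁ (∈-subtree⁻ c f∈))))
         (subtree-vertex-extends c' f∈' (baseOf∈ (proj₁ (∈-subtree⁻ c' f∈')))))))
    (mk⇔ to from)
    where
    to : ∀ {f} → f ∈ filterᵇ (not ∘ elem W) (subtree W) → f ∈ concatMap subtree (children W)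
    to {f} f∈ with ∈-filterᵇ⁻ (not ∘ elem W) (subtree W) f∈
    ... | f∈S , W∉f with ∈-subtree⁻ W f∈S
    ... | f∈T , [] , base≡ =
      ⊥-elim (true≢false (elem-true⁺ {W} {f} (subst (_∈ f) (trans base≡ (List.++-identityʳ W)) (baseOf∈ f∈T)))
                         (not-true⁻ W∉f))
    ... | f∈T , (e , u) ∷ r , base≡ = ∈-concatMap⁺′ subtree c∈ (∈-subtree⁺ (child W e u) r f∈T base≡′)
      where
      base≡′ : baseOf f ≡ child W e u ++ r
      base≡′ = trans base≡ (sym (List.++-assoc W [ (e , u) ] r))
      c∈ : child W e u ∈ children W
      c∈ = child∈children W e u h (isCF-prefix v (child W e u) r (subst (λ X → isCF v X ≡ true) base≡′ (baseOf-cf f∈T)))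

    from : ∀ {f} → f ∈ concatMap subtree (children W) → f ∈ filterᵇ (not ∘ elem W) (subtree W)
    from {f} f∈ with ∈-concatMap⁻′ subtree (children W) f∈
    ... | c , c∈ , f∈c with ∈-children⁻ W c∈ | ∈-subtree⁻ c f∈c
    ... | e , u , _ , _ , refl | f∈T , r , base≡ =
      ∈-filterᵇ⁺ (not ∘ elem W) (subtree W)
        (∈-subtree⁺ W ((e , u) ∷ r) f∈T (trans base≡ (List.++-assoc W [ (e , u) ] r)))
        (not-true⁺ (elem-false⁺ W∉f))
      where
      W∉f : W ∉ f
      W∉f W∈f with subtree-vertex-extends (child W e u) f∈c W∈f
      ... | r′ , eq = ++-∷-≢ W (trans eq (List.++-assoc W [ (e , u) ] r′))

  rootEdge-meets-subtree : ∀ W e {c g x} → c ∈ children W → g ∈ subtree c → x ∈ rootEdge W e → x ∈ g →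
                           x ≡ c × c ∈ ext W e
  rootEdge-meets-subtree W e {c} c∈ g∈ x∈ x∈g with ∈-children⁻ W c∈ | subtree-vertex-extends c g∈ x∈g
  rootEdge-meets-subtree W e c∈ g∈ (here refl) x∈g | e₀ , u₀ , _ , _ , refl | r , eq =
    ⊥-elim (++-∷-≢ W (trans eq (List.++-assoc W [ (e₀ , u₀) ] r)))
  rootEdge-meets-subtree W e {c} c∈ g∈ (there x∈) x∈g | _ , _ , _ , _ , refl | r , eq with ∈.∈-map⁻ (child W e) x∈
  ... | u , _ , refl = sym c≡x , subst (_∈ ext W e) (sym c≡x) x∈
    where
    c≡x : c ≡ child W e u
    c≡x = ++-injectiveˡ-length c (child W e u) (trans (sym eq) (sym (List.++-identityʳ _)))
            (trans (length-children W c∈) (sym (trans (List.length-++ W) (+-comm (length W) 1))))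

  rootEdge-disjoint-subtree : ∀ W e {c g} → c ∈ children W → g ∈ subtree c → c ∉ ext W e →
                              disjoint (rootEdge W e) g ≡ true
  rootEdge-disjoint-subtree W e c∈ g∈ c∉ =
    disjoint-true⁺ _ _ (λ x∈ x∈g → c∉ (proj₂ (rootEdge-meets-subtree W e c∈ g∈ x∈ x∈g)))

  rootEdge-disjoint-subtree-at : ∀ W e {c g} → c ∈ children W → g ∈ subtree c → c ∈ ext W e →
                                 disjoint (rootEdge W e) g ≡ not (elem c g)
  rootEdge-disjoint-subtree-at W e {c} {g} c∈ g∈ c∈e = true⇔⇒≡
    (λ disj → not-true⁺ (elem-false⁺ (disjoint-true⁻ {rootEdge W e} {g} disj (there c∈e))))
    (λ c∉g → disjoint-true⁺ _ _ (λ x∈ x∈g → true≢false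
       (elem-true⁺ (subst (_∈ g) (proj₁ (rootEdge-meets-subtree W e c∈ g∈ x∈ x∈g)) x∈g)) (not-true⁻ c∉g)))

-- Comparing the two probabilities

module Ratio {k : ℕ} (H : KGraph k) {_≺_ : Rel (Fin (n H)) 0ℓ} (≺-sto : IsStrictTotalOrder _≡_ _≺_) (v : Fin (n H)) where

  open Walks H ≺-sto
  open WalkTree H ≺-sto v
  private
    module VM = Matchings (Fin._≟_ {n H})
    module VC = MatchingCount (Fin._≟_ {n H})
    module WM = Matchings (walk-≟ H)
    module WC = MatchingCount (walk-≟ H)

  H∖ : List Vertex → List (List Vertex)
  H∖ R = map members (edgesAvoiding R)

  #H∖ : List Vertex → ℕ
  #H∖ R = VM.#matchings (H∖ R)

  H∖-filterᵇ : ∀ R (q : List Vertex → Bool) R' → (∀ e → avoidsAll e R ∧ q (members e) ≡ avoidsAll e R') →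
               filterᵇ q (H∖ R) ≡ H∖ R'
  H∖-filterᵇ R q R' same = trans (filterᵇ-map q members (edgesAvoiding R))
    (cong (map members) (trans (filterᵇ-filterᵇ _ _ (edges H)) (filterᵇ-cong-∈ _ (edges H) (λ {e} _ → same e))))

  H∖-avoiding : ∀ R w → filterᵇ (not ∘ VM.elem w) (H∖ R) ≡ H∖ (R ++ [ w ])
  H∖-avoiding R w = H∖-filterᵇ R _ (R ++ [ w ]) λ e →
    sym (trans (all-++ R [ w ]) (cong (avoidsAll e R ∧_) (trans (∧-identityʳ _) (cong not (sym (elem-members e w))))))

  H∖-disjoint : ∀ R e₀ → filterᵇ (VM.disjoint (members e₀)) (H∖ R) ≡ H∖ (R ++ members e₀)
  H∖-disjoint R e₀ = H∖-filterᵇ R _ (R ++ members e₀) λ e →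
    sym (trans (all-++ R (members e₀)) (cong (avoidsAll e R ∧_) (all-cong (members e₀) (λ x → cong not (sym (elem-members e x))))))

  H∖-through-end : ∀ W → isCF v W ≡ true → filterᵇ (VM.elem (end v W)) (H∖ (conflicts v W)) ≡ map members (roots W)
  H∖-through-end W h = trans (filterᵇ-map _ members (edgesAvoiding (conflicts v W)))
    (cong (map members) (trans (filterᵇ-filterᵇ _ _ (edges H)) (filterᵇ-cong-∈ _ (edges H) λ {e} e∈H →
       trans (cong (avoidsAll e (conflicts v W) ∧_) (elem-members e (end v W)))
             (trans (∧-comm (avoidsAll e (conflicts v W)) _) (sym (isTreeEdge-char v W e h e∈H))))))

  #H∖-cong : ∀ {R R'} → (∀ {x} → x ∈ R ⇔ x ∈ R') → #H∖ R ≡ #H∖ R'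
  #H∖-cong {R} {R'} R≈R' = cong (VM.#matchings ∘ map members) (filterᵇ-cong-∈ _ (edges H) λ {e} _ → true⇔⇒≡
    (λ avoids → all-intro R' (λ x∈ → all-elim avoids (Equivalence.from R≈R' x∈)))
    (λ avoids → all-intro R (λ x∈ → all-elim avoids (Equivalence.to R≈R' x∈))))

  #H∖-by-end : ∀ W → isCF v W ≡ true →
    #H∖ (conflicts v W) ≡ #H∖ (conflicts v W ++ [ end v W ]) + sum (map (λ e → #H∖ (conflicts v W ++ members e)) (roots W))
  #H∖-by-end W h = begin
    #H∖ R
      ≡⟨ VC.#matchings-by-vertex w (H∖ R) ⟩
    VM.#matchings (filterᵇ (not ∘ VM.elem w) (H∖ R)) + sum (map through (filterᵇ (VM.elem w) (H∖ R)))
      ≡⟨ cong₂ (λ E Es → VM.#matchings E + sum (map through Es)) (H∖-avoiding R w) (H∖-through-end W h) ⟩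
    #H∖ (R ++ [ w ]) + sum (map through (map members (roots W)))
      ≡⟨ cong (λ ns → #H∖ (R ++ [ w ]) + sum ns)
              (trans (sym (List.map-∘ (roots W))) (List.map-cong (cong VM.#matchings ∘ H∖-disjoint R) (roots W))) ⟩
    #H∖ (R ++ [ w ]) + sum (map (λ e → #H∖ (R ++ members e)) (roots W)) ∎
    where
    open ≡-Reasoning
    R = conflicts v W
    w = end v W
    through : List Vertex → ℕ
    through f = VM.#matchings (filterᵇ (VM.disjoint f) (H∖ R))

  #subtree : Walk H → ℕ
  #subtree W = WM.#matchings (subtree W)

  #subtree∖root : Walk H → ℕ
  #subtree∖root W = WM.#matchings (filterᵇ (not ∘ WM.elem W) (subtree W))

  #disjoint-from : Walk H → Edge → ℕ
  #disjoint-from W e = WM.#matchings (filterᵇ (WM.disjoint (rootEdge W e)) (subtree W))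

  #subtree-by-root : ∀ W → isCF v W ≡ true → #subtree W ≡ #subtree∖root W + sum (map (#disjoint-from W) (roots W))
  #subtree-by-root W h = trans (WC.#matchings-by-vertex W (subtree W)) (cong (#subtree∖root W +_)
    (trans (sum-↭ (↭.map⁺ (λ f → WM.#matchings (filterᵇ (WM.disjoint f) (subtree W))) (subtree-through-root-↭ W h)))
           (cong sum (sym (List.map-∘ (roots W))))))

  #subtree∖root-product : ∀ W → isCF v W ≡ true → #subtree∖root W ≡ product (map #subtree (children W))
  #subtree∖root-product W h = trans (WC.#matchings-↭ (subtree-below-root-↭ W h))
    (WC.#matchings-concatMap subtree (children W) (Unique-children W)
      (λ c∈ c'∈ c≢c' → subtree-disjoint W c∈ c'∈ c≢c'))

  inRootEdge : Walk H → Edge → Walk H → Bool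
  inRootEdge W e c = WM.elem c (ext W e)

  #disjoint-from-product : ∀ W e → isCF v W ≡ true →
    #disjoint-from W e ≡ product (map #subtree∖root (filterᵇ (inRootEdge W e) (children W)))
                         * product (map #subtree (filterᵇ (not ∘ inRootEdge W e) (children W)))
  #disjoint-from-product W e h = begin
    WM.#matchings (filterᵇ (WM.disjoint f) (subtree W))
      ≡⟨ cong WM.#matchings (filterᵇ-cong-∈ _ (subtree W) (λ {g} _ → misses-root g (WM.elem W g) refl)) ⟩
    WM.#matchings (filterᵇ ((not ∘ WM.elem W) ∩ WM.disjoint f) (subtree W))
      ≡⟨ cong WM.#matchings (sym (filterᵇ-filterᵇ (not ∘ WM.elem W) (WM.disjoint f) (subtree W))) ⟩
    WM.#matchings (filterᵇ (WM.disjoint f) (filterᵇ (not ∘ WM.elem W) (subtree W)))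
      ≡⟨ WC.#matchings-filterᵇ-↭ (subtree-below-root-↭ W h) (WM.disjoint f) ⟩
    WM.#matchings (filterᵇ (WM.disjoint f) (concatMap subtree (children W)))
      ≡⟨ cong WM.#matchings (filterᵇ-concatMap (WM.disjoint f) subtree (children W)) ⟩
    WM.#matchings (concatMap (filterᵇ (WM.disjoint f) ∘ subtree) (children W))
      ≡⟨ WC.#matchings-concatMap (filterᵇ (WM.disjoint f) ∘ subtree) (children W) (Unique-children W)
           (λ {c} {c'} c∈ c'∈ c≢c' g∈ g'∈ → subtree-disjoint W c∈ c'∈ c≢c' (filtered {c} g∈) (filtered {c'} g'∈)) ⟩
    product (map count (children W))
      ≡⟨ product-partition P count (children W) ⟩
    product (map count (filterᵇ P (children W))) * product (map count (filterᵇ (not ∘ P) (children W)))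
      ≡⟨ cong₂ _*_ (cong product (map-cong-∈ _ inside)) (cong product (map-cong-∈ _ outside)) ⟩
    product (map #subtree∖root (filterᵇ P (children W))) * product (map #subtree (filterᵇ (not ∘ P) (children W))) ∎
    where
    open ≡-Reasoning
    f = rootEdge W e
    P = inRootEdge W e
    count : Walk H → ℕ
    count c = WM.#matchings (filterᵇ (WM.disjoint f) (subtree c))
    filtered : ∀ {c g} → g ∈ filterᵇ (WM.disjoint f) (subtree c) → g ∈ subtree c
    filtered {c} g∈ = proj₁ (∈-filterᵇ⁻ _ (subtree c) g∈)
    misses-root : ∀ g b → WM.elem W g ≡ b → WM.disjoint f g ≡ not b ∧ WM.disjoint f g
    misses-root g true  W∈g = WC.disjoint-false⁺ {f} {g} (here refl) (WC.elem-true⁻ {W} {g} W∈g)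
    misses-root g false _   = refl
    inside : ∀ {c} → c ∈ filterᵇ P (children W) → count c ≡ #subtree∖root c
    inside {c} c∈ with ∈-filterᵇ⁻ P (children W) c∈
    ... | c∈ch , c∈e = cong WM.#matchings (filterᵇ-cong-∈ _ (subtree c)
      (λ g∈ → rootEdge-disjoint-subtree-at W e c∈ch g∈ (WC.elem-true⁻ {c} {ext W e} c∈e)))
    outside : ∀ {c} → c ∈ filterᵇ (not ∘ P) (children W) → count c ≡ #subtree c
    outside {c} c∈ with ∈-filterᵇ⁻ (not ∘ P) (children W) c∈
    ... | c∈ch , c∉e = cong WM.#matchings (filterᵇ-all _ (subtree c)
      (λ g∈ → rootEdge-disjoint-subtree W e c∈ch g∈ (λ c∈e → true≢false (WC.elem-true⁺ c∈e) (not-true⁻ c∉e))))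

  open SortBy ≺-sto using (sort; sort-↭; sort-strict; sorted-below)

  othersSorted : Walk H → Edge → List Vertex
  othersSorted W e = sort (others v W e)

  ∈-othersSorted : ∀ W e {x} → x ∈ othersSorted W e ⇔ x ∈ others v W e
  ∈-othersSorted W e = mk⇔ (↭.∈-resp-↭ (sort-↭ _)) (↭.∈-resp-↭ (↭-sym (sort-↭ _)))

  conflicts-child≈ : ∀ W e pre u post → othersSorted W e ≡ pre ++ u ∷ post →
    ∀ {x} → x ∈ conflicts v W ++ conflictSet (end v W) e u ⇔ x ∈ (conflicts v W ++ [ end v W ]) ++ pre
  conflicts-child≈ W e pre u post eq {x} = mk⇔ to from
    where
    R = conflicts v W
    w = end v W
    sorted : AllPairs _≺_ (pre ++ u ∷ post)
    sorted = subst (AllPairs _≺_) eq (sort-strict _ (Unique.filter⁺ _ (Unique-members e)))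
    in-list : ∀ {y} → y ∈ others v W e → y ∈ pre ++ u ∷ post
    in-list y∈ = subst (_ ∈_) eq (Equivalence.from (∈-othersSorted W e) y∈)
    to : x ∈ R ++ conflictSet w e u → x ∈ (R ++ [ w ]) ++ pre
    to x∈ with ∈.∈-++⁻ R x∈
    ... | inj₁ x∈R = ∈.∈-++⁺ˡ (∈.∈-++⁺ˡ x∈R)
    ... | inj₂ x∈C with ∈-conflictSet⁻ w e u x∈C
    ...   | inj₁ refl                   = ∈.∈-++⁺ˡ (∈.∈-++⁺ʳ R (here refl))
    ...   | inj₂ (e∋x , x≢w , _ , x≺u) =
      ∈.∈-++⁺ʳ (R ++ [ w ]) (Equivalence.to (sorted-below pre sorted (in-list (∈-others⁺ v W e e∋x x≢w))) x≺u)
    from : x ∈ (R ++ [ w ]) ++ pre → x ∈ R ++ conflictSet w e u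
    from x∈ with ∈.∈-++⁻ (R ++ [ w ]) x∈
    ... | inj₂ x∈pre = ∈.∈-++⁺ʳ R (∈-conflictSet⁺ w e u e∋x x≢w (λ x≡u → irrefl x≡u x≺u) x≺u)
      where
      x∈others : x ∈ others v W e
      x∈others = Equivalence.to (∈-othersSorted W e) (subst (_ ∈_) (sym eq) (∈.∈-++⁺ˡ x∈pre))
      e∋x : lookup e x ≡ true
      e∋x = proj₁ (∈-others⁻ v W e x∈others)
      x≢w : x ≢ w
      x≢w = proj₂ (∈-others⁻ v W e x∈others)
      x≺u : x ≺ u
      x≺u = Equivalence.from (sorted-below pre sorted (∈.∈-++⁺ˡ x∈pre)) x∈pre
      open IsStrictTotalOrder ≺-sto using (irrefl)
    ... | inj₁ x∈Rw with ∈.∈-++⁻ R x∈Rw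
    ...   | inj₁ x∈R         = ∈.∈-++⁺ˡ x∈R
    ...   | inj₂ (here refl) = ∈.∈-++⁺ʳ R (here refl)

  members≈ : ∀ W e → lookup e (end v W) ≡ true →
    ∀ {x} → x ∈ conflicts v W ++ members e ⇔ x ∈ (conflicts v W ++ [ end v W ]) ++ othersSorted W e
  members≈ W e e∋w {x} = mk⇔ to from
    where
    R = conflicts v W
    w = end v W
    to : x ∈ R ++ members e → x ∈ (R ++ [ w ]) ++ othersSorted W e
    to x∈ with ∈.∈-++⁻ R x∈
    ... | inj₁ x∈R = ∈.∈-++⁺ˡ (∈.∈-++⁺ˡ x∈R)
    ... | inj₂ x∈e with x Fin.≟ w
    ...   | yes refl  = ∈.∈-++⁺ˡ (∈.∈-++⁺ʳ R (here refl))
    ...   | no  x≢w   = ∈.∈-++⁺ʳ (R ++ [ w ])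
                          (Equivalence.from (∈-othersSorted W e) (∈-others⁺ v W e (∈-members⁻ e x∈e) x≢w))
    from : x ∈ (R ++ [ w ]) ++ othersSorted W e → x ∈ R ++ members e
    from x∈ with ∈.∈-++⁻ (R ++ [ w ]) x∈
    ... | inj₂ x∈s = ∈.∈-++⁺ʳ R (∈-members⁺ e (proj₁ (∈-others⁻ v W e (Equivalence.to (∈-othersSorted W e) x∈s))))
    ... | inj₁ x∈Rw with ∈.∈-++⁻ R x∈Rw
    ...   | inj₁ x∈R         = ∈.∈-++⁺ˡ x∈R
    ...   | inj₂ (here refl) = ∈.∈-++⁺ʳ R (∈-members⁺ e e∋w)

  -- P_{T_W}(W̄) = P_{H − R}(w̄), cross-multiplied, for the conflicts R and the end w of W
  ProbabilitiesAgree : Walk H → Set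
  ProbabilitiesAgree W = #subtree∖root W * #H∖ (conflicts v W) ≡ #subtree W * #H∖ (conflicts v W ++ [ end v W ])

  children-in-rootEdge↭ : ∀ W {e} → e ∈ roots W → filterᵇ (inRootEdge W e) (children W) ↭ ext W e
  children-in-rootEdge↭ W {e} e∈roots =
    unique-set⇒↭ (Unique.filter⁺ _ (Unique-children W)) (Unique-ext W e) (mk⇔
      (λ c∈ → WC.elem-true⁻ {_} {ext W e} (proj₂ (∈-filterᵇ⁻ (inRootEdge W e) (children W) c∈)))
      (λ c∈ → ∈-filterᵇ⁺ (inRootEdge W e) (children W) (∈-concatMap⁺′ (ext W) e∈roots c∈) (WC.elem-true⁺ c∈)))

  product-children-in-rootEdge : ∀ W {e} → e ∈ roots W → ∀ (F : Walk H → ℕ) →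
    product (map F (filterᵇ (inRootEdge W e) (children W))) ≡ product (map (F ∘ child W e) (othersSorted W e))
  product-children-in-rootEdge W {e} e∈roots F = begin
    product (map F (filterᵇ (inRootEdge W e) (children W)))
      ≡⟨ product-↭ (↭.map⁺ F (children-in-rootEdge↭ W e∈roots)) ⟩
    product (map F (map (child W e) (others v W e)))
      ≡⟨ cong product (sym (List.map-∘ (others v W e))) ⟩
    product (map (F ∘ child W e) (others v W e))
      ≡⟨ product-↭ (↭.map⁺ (F ∘ child W e) (↭-sym (sort-↭ _))) ⟩
    product (map (F ∘ child W e) (othersSorted W e)) ∎
    where open ≡-Reasoning

  agree-at-child : ∀ W e pre u post → othersSorted W e ≡ pre ++ u ∷ post → ProbabilitiesAgree (child W e u) →
    #subtree∖root (child W e u) * #H∖ ((conflicts v W ++ [ end v W ]) ++ pre) ≡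
    #subtree (child W e u) * #H∖ ((conflicts v W ++ [ end v W ]) ++ pre ++ [ u ])
  agree-at-child W e pre u post eq agree = begin
    #subtree∖root c * #H∖ (Rw ++ pre)
      ≡⟨ cong (#subtree∖root c *_) (#H∖-cong (⇔-sym (conflicts-child≈ W e pre u post eq))) ⟩
    #subtree∖root c * #H∖ (R ++ conflictSet w e u)
      ≡⟨ cong (λ X → #subtree∖root c * #H∖ X) (sym (conflicts-∷ʳ v W e u)) ⟩
    #subtree∖root c * #H∖ (conflicts v c)
      ≡⟨ agree ⟩
    #subtree c * #H∖ (conflicts v c ++ [ end v c ])
      ≡⟨ cong₂ (λ X y → #subtree c * #H∖ (X ++ [ y ])) (conflicts-∷ʳ v W e u) (end-∷ʳ v W e u) ⟩
    #subtree c * #H∖ ((R ++ conflictSet w e u) ++ [ u ])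
      ≡⟨ cong (#subtree c *_) (#H∖-cong (++-cong (conflicts-child≈ W e pre u post eq) ⇔-refl)) ⟩
    #subtree c * #H∖ ((Rw ++ pre) ++ [ u ])
      ≡⟨ cong (λ X → #subtree c * #H∖ X) (List.++-assoc Rw pre [ u ]) ⟩
    #subtree c * #H∖ (Rw ++ pre ++ [ u ]) ∎
    where
    open ≡-Reasoning
    c  = child W e u
    R  = conflicts v W
    w  = end v W
    Rw = R ++ [ w ]

  through-root-edge : ∀ W e → isCF v W ≡ true → e ∈ roots W →
    (∀ {u} → u ∈ others v W e → ProbabilitiesAgree (child W e u)) →
    #subtree∖root W * #H∖ (conflicts v W ++ members e) ≡ #disjoint-from W e * #H∖ (conflicts v W ++ [ end v W ])
  through-root-edge W e h e∈roots agree = begin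
    #subtree∖root W * #H∖ (R ++ members e)
      ≡⟨ cong₂ _*_ (trans (#subtree∖root-product W h) (product-partition P #subtree (children W)))
                   (#H∖-cong (members≈ W e (roots-contain-end W e∈roots))) ⟩
    Π P #subtree * Π (not ∘ P) #subtree * #H∖ (Rw ++ ss)
      ≡⟨ cong (λ a → a * Π (not ∘ P) #subtree * #H∖ (Rw ++ ss)) (product-children-in-rootEdge W e∈roots #subtree) ⟩
    Πss #subtree * Π (not ∘ P) #subtree * #H∖ (Rw ++ ss)
      ≡⟨ rearrange (Πss #subtree) (Π (not ∘ P) #subtree) (#H∖ (Rw ++ ss)) ⟩
    Π (not ∘ P) #subtree * (Πss #subtree * #H∖ (Rw ++ ss))
      ≡⟨ cong (Π (not ∘ P) #subtree *_) (telescope #H∖ (#subtree ∘ child W e) (#subtree∖root ∘ child W e) Rw ss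
           (λ pre u post eq → agree-at-child W e pre u post eq (agree (sorted∈others eq)))) ⟩
    Π (not ∘ P) #subtree * (#H∖ Rw * Πss #subtree∖root)
      ≡⟨ rearrange′ (Π (not ∘ P) #subtree) (#H∖ Rw) (Πss #subtree∖root) ⟩
    Πss #subtree∖root * Π (not ∘ P) #subtree * #H∖ Rw
      ≡⟨ cong (λ a → a * Π (not ∘ P) #subtree * #H∖ Rw) (sym (product-children-in-rootEdge W e∈roots #subtree∖root)) ⟩
    Π P #subtree∖root * Π (not ∘ P) #subtree * #H∖ Rw
      ≡⟨ cong (_* #H∖ Rw) (sym (#disjoint-from-product W e h)) ⟩
    #disjoint-from W e * #H∖ Rw ∎
    where
    open ≡-Reasoning
    R  = conflicts v W
    Rw = R ++ [ end v W ]
    ss = othersSorted W e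
    P  = inRootEdge W e
    Π : (Walk H → Bool) → (Walk H → ℕ) → ℕ
    Π q F = product (map F (filterᵇ q (children W)))
    Πss : (Walk H → ℕ) → ℕ
    Πss F = product (map (F ∘ child W e) ss)
    sorted∈others : ∀ {pre u post} → ss ≡ pre ++ u ∷ post → u ∈ others v W e
    sorted∈others {pre} eq = Equivalence.to (∈-othersSorted W e) (subst (_ ∈_) (sym eq) (∈.∈-++⁺ʳ pre (here refl)))
    rearrange : ∀ a b c → a * b * c ≡ b * (a * c)
    rearrange = solve-∀
    rearrange′ : ∀ b c a → b * (c * a) ≡ a * b * c
    rearrange′ = solve-∀

  probabilities-agree-bounded : ∀ d W → isCF v W ≡ true → length (edgesAvoiding (conflicts v W)) < d → ProbabilitiesAgree W
  probabilities-agree-bounded (suc d) W h (s≤s bound) = begin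
    #subtree∖root W * #H∖ R
      ≡⟨ cong (#subtree∖root W *_) (#H∖-by-end W h) ⟩
    #subtree∖root W * (#H∖ Rw + sum (map (λ e → #H∖ (R ++ members e)) (roots W)))
      ≡⟨ *-distribˡ-+ (#subtree∖root W) (#H∖ Rw) _ ⟩
    #subtree∖root W * #H∖ Rw + #subtree∖root W * sum (map (λ e → #H∖ (R ++ members e)) (roots W))
      ≡⟨ cong (#subtree∖root W * #H∖ Rw +_) (*-distribˡ-sum (#subtree∖root W) _ (roots W)) ⟩
    #subtree∖root W * #H∖ Rw + sum (map (λ e → #subtree∖root W * #H∖ (R ++ members e)) (roots W))
      ≡⟨ cong (λ ns → #subtree∖root W * #H∖ Rw + sum ns)
              (map-cong-∈ (roots W) (λ {e} e∈ → through-root-edge W e h e∈ (IH e∈))) ⟩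
    #subtree∖root W * #H∖ Rw + sum (map (λ e → #disjoint-from W e * #H∖ Rw) (roots W))
      ≡⟨ cong (#subtree∖root W * #H∖ Rw +_) (sym (*-distribʳ-sum (#H∖ Rw) (#disjoint-from W) (roots W))) ⟩
    #subtree∖root W * #H∖ Rw + sum (map (#disjoint-from W) (roots W)) * #H∖ Rw
      ≡⟨ sym (*-distribʳ-+ (#H∖ Rw) (#subtree∖root W) _) ⟩
    (#subtree∖root W + sum (map (#disjoint-from W) (roots W))) * #H∖ Rw
      ≡⟨ cong (_* #H∖ Rw) (sym (#subtree-by-root W h)) ⟩
    #subtree W * #H∖ Rw ∎
    where
    open ≡-Reasoning
    R  = conflicts v W
    Rw = R ++ [ end v W ]
    IH : ∀ {e} → e ∈ roots W → ∀ {u} → u ∈ others v W e → ProbabilitiesAgree (child W e u)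
    IH {e} e∈ {u} u∈ = probabilities-agree-bounded d (child W e u) h′
      (subst (λ X → length (edgesAvoiding X) < d) (sym (conflicts-∷ʳ v W e u))
             (<-≤-trans (edgesAvoiding-step R (end v W) e u e∈H avoids e∋w) bound))
      where
      e∈H : e ∈ edges H
      e∈H = proj₁ (∈-filterᵇ⁻ _ (edges H) e∈)
      isRoot : lookup e (end v W) ∧ avoidsAll e R ≡ true
      isRoot = trans (sym (isTreeEdge-char v W e h e∈H)) (proj₂ (∈-filterᵇ⁻ _ (edges H) e∈))
      e∋w : lookup e (end v W) ≡ true
      e∋w = ∧-trueˡ isRoot
      avoids : avoidsAll e R ≡ true
      avoids = ∧-trueʳ {lookup e (end v W)} isRoot
      h′ : isCF v (child W e u) ≡ true
      h′ = isCF-∷ʳ⁺ v W e u h record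
        { edgeOfH = e∈H ; containsEnd = e∋w ; containsU = proj₁ (∈-others⁻ v W e u∈)
        ; u≢end = proj₂ (∈-others⁻ v W e u∈) ; avoidsConflicts = avoids }

  probabilities-agree : ∀ W → isCF v W ≡ true → ProbabilitiesAgree W
  probabilities-agree W h = probabilities-agree-bounded _ W h (n<1+n _)

  #subtree-[] : #subtree [] ≡ WM.#matchings (walkTreeEdges H ≺-sto v)
  #subtree-[] = cong WM.#matchings subtree-[]≡treeEdges

  #subtree∖root-[] : #subtree∖root [] ≡ WM.#avoiding (walkTreeEdges H ≺-sto v) []
  #subtree∖root-[] = trans (cong (λ E → WM.#matchings (filterᵇ (not ∘ WM.elem []) E)) subtree-[]≡treeEdges)
                           (sym (WC.#avoiding-#matchings (walkTreeEdges H ≺-sto v) []))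

  #H∖-[] : #H∖ [] ≡ VM.#matchings (map members (edges H))
  #H∖-[] = cong (VM.#matchings ∘ map members) edgesAvoiding-[]

  #H∖-[v] : #H∖ [ v ] ≡ VM.#avoiding (map members (edges H)) v
  #H∖-[v] = begin
    #H∖ [ v ]
      ≡⟨ cong VM.#matchings (sym (H∖-avoiding [] v)) ⟩
    VM.#matchings (filterᵇ (not ∘ VM.elem v) (H∖ []))
      ≡⟨ cong (λ E → VM.#matchings (filterᵇ _ (map members E))) edgesAvoiding-[] ⟩
    VM.#matchings (filterᵇ (not ∘ VM.elem v) (map members (edges H)))
      ≡⟨ sym (VC.#avoiding-#matchings (map members (edges H)) v) ⟩
    VM.#avoiding (map members (edges H)) v ∎
    where open ≡-Reasoning

/-cross : ∀ a b A B .{{_ : NonZero b}} .{{_ : NonZero B}} → a * B ≡ A * b → (ℤ.+ a) / b ≡ (ℤ.+ A) / B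
/-cross a (suc b) A (suc B) eq =
  fromℚᵘ-cong {mkℚᵘ (ℤ.+ a) b} {mkℚᵘ (ℤ.+ A) B} (*≡* (trans (sym (pos-* a (suc B))) (trans (cong ℤ.+_ eq) (pos-* A (suc b)))))

corollary3p8 : {k : ℕ} (H : KGraph k) (v : Fin (n H))
               {_≺_ : Rel (Fin (n H)) 0ℓ} (≺-sto : IsStrictTotalOrder _≡_ _≺_) →
               probH H v ≡ probT H ≺-sto v
corollary3p8 H v ≺-sto =
  /-cross (HM.#avoiding H-edges v) (HM.#matchings H-edges) (TM.#avoiding T-edges []) (TM.#matchings T-edges)
          {{HM.#matchings-nonZero H-edges}} {{TM.#matchings-nonZero T-edges}} (begin
    HM.#avoiding H-edges v * TM.#matchings T-edges  ≡⟨ *-comm (HM.#avoiding H-edges v) _ ⟩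
    TM.#matchings T-edges * HM.#avoiding H-edges v  ≡⟨ sym (cong₂ _*_ #subtree-[] #H∖-[v]) ⟩
    #subtree [] * #H∖ [ v ]                         ≡⟨ sym (probabilities-agree [] refl) ⟩
    #subtree∖root [] * #H∖ []                       ≡⟨ cong₂ _*_ #subtree∖root-[] #H∖-[] ⟩
    TM.#avoiding T-edges [] * HM.#matchings H-edges ∎)
  where
  open ≡-Reasoning
  open Ratio H ≺-sto v
  module HM = Matchings (Fin._≟_ {n H})
  module TM = Matchings (walk-≟ H)
  H-edges = map members (edges H)
  T-edges = walkTreeEdges H ≺-sto v
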